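{- Let $\mathcal S$ be one of $2_{\mathsf D},2_{\mathsf T},2_{\mathsf{S4}}$. Let $n\in\mathbb N$ and let $A^\alpha$ be a p-formula of degree $n$. Let $\Pi,\Pi'$ be $\mathcal S$-proofs of $\Gamma\vdash\Delta$ and $\Gamma'\vdash\Delta'$ respectively, with $g(\Pi)\le n$ and $g(\Pi')\le n$. Then one can effectively obtain from $\Pi$ and $\Pi'$ an $\mathcal S$-proof of $\Gamma,\Gamma'_{ -A^\alpha}\vdash\Delta_{ -A^\alpha},\Delta'$ whose degree is $\le n$.
   Context: Modal formulas over proposition symbols with $\neg,\wedge,\vee,\to,\Box,\Diamond$. Fix a countably infinite set of tokens; a position is a finite (possibly empty) sequence of tokens, $\circ$ concatenation, $\alpha\circ x=\alpha\circ\langle x\rangle$, $\beta\preceq\alpha$ means $\beta$ is a prefix of $\alpha$. A p-formula is $A^\alpha$; a 2-sequent is $\Gamma\vdash\Delta$ with $\Gamma,\Delta$ finite sequences of p-formulas; $I(\Gamma)=\{\beta:\exists A^\alpha\in\Gamma,\ \beta\preceq\alpha\}$. For a sequence $\Gamma$, $\Gamma_{ -A^\alpha}$ denotes $\Gamma$ with all occurrences of $A^\alpha$ removed. Degree: $\deg(p)=0$; $\deg(\neg A)=\deg(\Box A)=\deg(\Diamond A)=\deg(A)+1$; $\deg(A\#B)=\max(\deg A,\deg B)+1$ for $\#\in\{\wedge,\vee,\to\}$; $\deg(A^\alpha)=\deg(A)$. The degree $g(\Pi)$ of a proof is $0$ if $\Pi$ has no Cut, and otherwise the supremum of $\deg(A^\alpha)+1$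 over cut formulas $A^\alpha$ of $\Pi$. Calculus $2_{\mathsf{S4}}$: Axiom $A^\alpha\vdash A^\alpha$; Cut: from $\Gamma_1\vdash A^\alpha,\Delta_1$ and $\Gamma_2,A^\alpha\vdash\Delta_2$ infer $\Gamma_1,\Gamma_2\vdash\Delta_1,\Delta_2$; weakening, contraction, exchange; classical propositional sequent rules for $\neg,\wedge,\vee,\to$ (two-premise rules with contexts joined) with all active p-formulas at the same position; modal rules: ($\Box\vdash$) from $\Gamma,A^{\alpha\circ\beta}\vdash\Delta$ infer $\Gamma,(\Box A)^\alpha\vdash\Delta$; ($\vdash\Box$) from $\Gamma\vdash A^{\alpha\circ x},\Delta$ infer $\Gamma\vdash(\Box A)^\alpha,\Delta$; ($\Diamond\vdash$) from $\Gamma,A^{\alpha\circ x}\vdash\Delta$ infer $\Gamma,(\Diamond A)^\alpha\vdash\Delta$; ($\vdash\Diamond$) from $\Gamma\vdash A^{\alpha\circ\beta},\Delta$ infer $\Gamma\vdash(\Diamond A)^\alpha,\Delta$; $\beta$ a position, $x$ a token, and in $\vdash\Box,\Diamond\vdash$, $\alpha\circ x\notin I(\Gamma,\Delta)$. $2_{\mathsf T}$ restricts $\Box\vdash,\vdash\Diamond$ to $\beta$ empty or a single token; $2_{\mathsf D}$ restricts them to $\beta$ a single token. -}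

module Defs where

open import Data.Nat using (ℕ; zero; suc; _≤_; _⊔_) renaming (_≟_ to _≟ℕ_)
open import Data.List using (List; []; _∷_; _++_; [_]; length; filter)
open import Data.List.Relation.Unary.Any using (Any)
open import Data.Product using (Σ; ∃; _×_; _,_)
open import Data.Unit using (⊤)
open import Relation.Nullary using (¬_; Dec; yes; no)
open import Relation.Nullary.Decidable using (map′; _×-dec_)
open import Relation.Binary.PropositionalEquality using (_≡_; refl; cong; cong₂)
import Data.List.Properties as LP

PropSym : Set
PropSym = ℕ

Token : Set
Token = ℕ

Position : Set
Position = List Token

_∘ₜ_ : Position → Token → Position
α ∘ₜ x = α ++ [ x ]

_⪯_ : Position → Position → Set
β ⪯ α = Σ Position (λ γ → β ++ γ ≡ α)

infixr 6 _∧ᶠ_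
infixr 5 _∨ᶠ_
infixr 4 _⇒ᶠ_

data Formula : Set where
  var   : PropSym → Formula
  ¬ᶠ_   : Formula → Formula
  _∧ᶠ_  : Formula → Formula → Formula
  _∨ᶠ_  : Formula → Formula → Formula
  _⇒ᶠ_  : Formula → Formula → Formula
  □_    : Formula → Formula
  ◇_    : Formula → Formula

deg : Formula → ℕ
deg (var p)   = 0
deg (¬ᶠ A)    = suc (deg A)
deg (A ∧ᶠ B)  = suc (deg A ⊔ deg B)
deg (A ∨ᶠ B)  = suc (deg A ⊔ deg B)
deg (A ⇒ᶠ B)  = suc (deg A ⊔ deg B)
deg (□ A)     = suc (deg A)
deg (◇ A)     = suc (deg A)

record PFormula : Set where
  constructor _^_
  field
    fml : Formula
    pos : Position
open PFormula public

pdeg : PFormula → ℕ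
pdeg (A ^ α) = deg A

_≟F_ : (A B : Formula) → Dec (A ≡ B)
var p ≟F var q with p ≟ℕ q
... | yes refl = yes refl
... | no ne = no λ { refl → ne refl }
var _ ≟F (¬ᶠ _) = no λ ()
var _ ≟F (_ ∧ᶠ _) = no λ ()
var _ ≟F (_ ∨ᶠ _) = no λ ()
var _ ≟F (_ ⇒ᶠ _) = no λ ()
var _ ≟F (□ _) = no λ ()
var _ ≟F (◇ _) = no λ ()
(¬ᶠ A) ≟F (¬ᶠ B) with A ≟F B
... | yes refl = yes refl
... | no ne = no λ { refl → ne refl }
(¬ᶠ _) ≟F var _ = no λ ()
(¬ᶠ _) ≟F (_ ∧ᶠ _) = no λ ()
(¬ᶠ _) ≟F (_ ∨ᶠ _) = no λ ()
(¬ᶠ _) ≟F (_ ⇒ᶠ _) = no λ ()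
(¬ᶠ _) ≟F (□ _) = no λ ()
(¬ᶠ _) ≟F (◇ _) = no λ ()
(A ∧ᶠ B) ≟F (C ∧ᶠ D) with A ≟F C | B ≟F D
... | yes refl | yes refl = yes refl
... | no ne | _ = no λ { refl → ne refl }
... | yes _ | no ne = no λ { refl → ne refl }
(_ ∧ᶠ _) ≟F var _ = no λ ()
(_ ∧ᶠ _) ≟F (¬ᶠ _) = no λ ()
(_ ∧ᶠ _) ≟F (_ ∨ᶠ _) = no λ ()
(_ ∧ᶠ _) ≟F (_ ⇒ᶠ _) = no λ ()
(_ ∧ᶠ _) ≟F (□ _) = no λ ()
(_ ∧ᶠ _) ≟F (◇ _) = no λ ()
(A ∨ᶠ B) ≟F (C ∨ᶠ D) with A ≟F C | B ≟F D
... | yes refl | yes refl = yes refl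
... | no ne | _ = no λ { refl → ne refl }
... | yes _ | no ne = no λ { refl → ne refl }
(_ ∨ᶠ _) ≟F var _ = no λ ()
(_ ∨ᶠ _) ≟F (¬ᶠ _) = no λ ()
(_ ∨ᶠ _) ≟F (_ ∧ᶠ _) = no λ ()
(_ ∨ᶠ _) ≟F (_ ⇒ᶠ _) = no λ ()
(_ ∨ᶠ _) ≟F (□ _) = no λ ()
(_ ∨ᶠ _) ≟F (◇ _) = no λ ()
(A ⇒ᶠ B) ≟F (C ⇒ᶠ D) with A ≟F C | B ≟F D
... | yes refl | yes refl = yes refl
... | no ne | _ = no λ { refl → ne refl }
... | yes _ | no ne = no λ { refl → ne refl }
(_ ⇒ᶠ _) ≟F var _ = no λ ()
(_ ⇒ᶠ _) ≟F (¬ᶠ _) = no λ ()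
(_ ⇒ᶠ _) ≟F (_ ∧ᶠ _) = no λ ()
(_ ⇒ᶠ _) ≟F (_ ∨ᶠ _) = no λ ()
(_ ⇒ᶠ _) ≟F (□ _) = no λ ()
(_ ⇒ᶠ _) ≟F (◇ _) = no λ ()
(□ A) ≟F (□ B) with A ≟F B
... | yes refl = yes refl
... | no ne = no λ { refl → ne refl }
(□ _) ≟F var _ = no λ ()
(□ _) ≟F (¬ᶠ _) = no λ ()
(□ _) ≟F (_ ∧ᶠ _) = no λ ()
(□ _) ≟F (_ ∨ᶠ _) = no λ ()
(□ _) ≟F (_ ⇒ᶠ _) = no λ ()
(□ _) ≟F (◇ _) = no λ ()
(◇ A) ≟F (◇ B) with A ≟F B
... | yes refl = yes refl
... | no ne = no λ { refl → ne refl }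
(◇ _) ≟F var _ = no λ ()
(◇ _) ≟F (¬ᶠ _) = no λ ()
(◇ _) ≟F (_ ∧ᶠ _) = no λ ()
(◇ _) ≟F (_ ∨ᶠ _) = no λ ()
(◇ _) ≟F (_ ⇒ᶠ _) = no λ ()
(◇ _) ≟F (□ _) = no λ ()

_≟P_ : (P Q : PFormula) → Dec (P ≡ Q)
(A ^ α) ≟P (B ^ β) with A ≟F B | LP.≡-dec _≟ℕ_ α β
... | yes refl | yes refl = yes refl
... | no ne | _ = no λ { refl → ne refl }
... | yes _ | no ne = no λ { refl → ne refl }

_₋_ : List PFormula → PFormula → List PFormula
[] ₋ P = []
(Q ∷ Γ) ₋ P with Q ≟P P
... | yes _ = Γ ₋ P
... | no _  = Q ∷ (Γ ₋ P)

_∈I_ : Position → List PFormula → Set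
β ∈I Γ = Any (λ P → β ⪯ pos P) Γ

data System : Set where
  2D 2T 2S4 : System

Allowed : System → Position → Set
Allowed 2D  β = length β ≡ 1
Allowed 2T  β = length β ≤ 1
Allowed 2S4 β = ⊤

data Proof (S : System) : List PFormula → List PFormula → Set where
  ax    : ∀ P → Proof S [ P ] [ P ]
  cut   : ∀ {Γ₁ Δ₁ Γ₂ Δ₂} P →
          Proof S Γ₁ (P ∷ Δ₁) → Proof S (Γ₂ ++ [ P ]) Δ₂ →
          Proof S (Γ₁ ++ Γ₂) (Δ₁ ++ Δ₂)
  wL    : ∀ {Γ Δ} P → Proof S Γ Δ → Proof S (Γ ++ [ P ]) Δ
  wR    : ∀ {Γ Δ} P → Proof S Γ Δ → Proof S Γ (P ∷ Δ)
  cL    : ∀ {Γ Δ} P → Proof S (Γ ++ P ∷ P ∷ []) Δ → Proof S (Γ ++ [ P ]) Δ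
  cR    : ∀ {Γ Δ} P → Proof S Γ (P ∷ P ∷ Δ) → Proof S Γ (P ∷ Δ)
  eL    : ∀ {Γ₁ Γ₂ Δ} P Q → Proof S (Γ₁ ++ P ∷ Q ∷ Γ₂) Δ → Proof S (Γ₁ ++ Q ∷ P ∷ Γ₂) Δ
  eR    : ∀ {Γ Δ₁ Δ₂} P Q → Proof S Γ (Δ₁ ++ P ∷ Q ∷ Δ₂) → Proof S Γ (Δ₁ ++ Q ∷ P ∷ Δ₂)
  ¬L    : ∀ {Γ Δ} A α → Proof S Γ ((A ^ α) ∷ Δ) → Proof S (Γ ++ [ (¬ᶠ A) ^ α ]) Δ
  ¬R    : ∀ {Γ Δ} A α → Proof S (Γ ++ [ A ^ α ]) Δ → Proof S Γ (((¬ᶠ A) ^ α) ∷ Δ)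
  ∧L₁   : ∀ {Γ Δ} A B α → Proof S (Γ ++ [ A ^ α ]) Δ → Proof S (Γ ++ [ (A ∧ᶠ B) ^ α ]) Δ
  ∧L₂   : ∀ {Γ Δ} A B α → Proof S (Γ ++ [ B ^ α ]) Δ → Proof S (Γ ++ [ (A ∧ᶠ B) ^ α ]) Δ
  ∧R    : ∀ {Γ₁ Δ₁ Γ₂ Δ₂} A B α →
          Proof S Γ₁ ((A ^ α) ∷ Δ₁) → Proof S Γ₂ ((B ^ α) ∷ Δ₂) →
          Proof S (Γ₁ ++ Γ₂) (((A ∧ᶠ B) ^ α) ∷ (Δ₁ ++ Δ₂))
  ∨L    : ∀ {Γ₁ Δ₁ Γ₂ Δ₂} A B α →
          Proof S (Γ₁ ++ [ A ^ α ]) Δ₁ → Proof S (Γ₂ ++ [ B ^ α ]) Δ₂ →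
          Proof S (Γ₁ ++ Γ₂ ++ [ (A ∨ᶠ B) ^ α ]) (Δ₁ ++ Δ₂)
  ∨R₁   : ∀ {Γ Δ} A B α → Proof S Γ ((A ^ α) ∷ Δ) → Proof S Γ (((A ∨ᶠ B) ^ α) ∷ Δ)
  ∨R₂   : ∀ {Γ Δ} A B α → Proof S Γ ((B ^ α) ∷ Δ) → Proof S Γ (((A ∨ᶠ B) ^ α) ∷ Δ)
  ⇒L    : ∀ {Γ₁ Δ₁ Γ₂ Δ₂} A B α →
          Proof S Γ₁ ((A ^ α) ∷ Δ₁) → Proof S (Γ₂ ++ [ B ^ α ]) Δ₂ →
          Proof S (Γ₁ ++ Γ₂ ++ [ (A ⇒ᶠ B) ^ α ]) (Δ₁ ++ Δ₂)
  ⇒R    : ∀ {Γ Δ} A B α → Proof S (Γ ++ [ A ^ α ]) ((B ^ α) ∷ Δ) →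
          Proof S Γ (((A ⇒ᶠ B) ^ α) ∷ Δ)
  □L    : ∀ {Γ Δ} A α β → Allowed S β → Proof S (Γ ++ [ A ^ (α ++ β) ]) Δ →
          Proof S (Γ ++ [ (□ A) ^ α ]) Δ
  □R    : ∀ {Γ Δ} A α x → ¬ ((α ∘ₜ x) ∈I (Γ ++ Δ)) → Proof S Γ ((A ^ (α ∘ₜ x)) ∷ Δ) →
          Proof S Γ (((□ A) ^ α) ∷ Δ)
  ◇L    : ∀ {Γ Δ} A α x → ¬ ((α ∘ₜ x) ∈I (Γ ++ Δ)) → Proof S (Γ ++ [ A ^ (α ∘ₜ x) ]) Δ →
          Proof S (Γ ++ [ (◇ A) ^ α ]) Δ
  ◇R    : ∀ {Γ Δ} A α β → Allowed S β → Proof S Γ ((A ^ (α ++ β)) ∷ Δ) →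
          Proof S Γ (((◇ A) ^ α) ∷ Δ)

g : ∀ {S Γ Δ} → Proof S Γ Δ → ℕ
g (ax _) = 0
g (cut P π π′) = suc (pdeg P) ⊔ (g π ⊔ g π′)
g (wL _ π) = g π
g (wR _ π) = g π
g (cL _ π) = g π
g (cR _ π) = g π
g (eL _ _ π) = g π
g (eR _ _ π) = g π
g (¬L _ _ π) = g π
g (¬R _ _ π) = g π
g (∧L₁ _ _ _ π) = g π
g (∧L₂ _ _ _ π) = g π
g (∧R _ _ _ π π′) = g π ⊔ g π′
g (∨L _ _ _ π π′) = g π ⊔ g π′
g (∨R₁ _ _ _ π) = g π
g (∨R₂ _ _ _ π) = g π
g (⇒L _ _ _ π π′) = g π ⊔ g π′
g (⇒R _ _ _ π) = g π
g (□L _ _ _ _ π) = g π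
g (□R _ _ _ _ π) = g π
g (◇L _ _ _ _ π) = g π
g (◇R _ _ _ _ π) = g π

module Submission where

-- The argument is by inversion.  Its engine is one generic traversal
-- (module Traversal): it rebuilds a proof of Γ ⊢ Δ into a proof of
--   σ(Γ⁻) ++ Eₗ ⊢ σ(Δ⁻) ++ Eᵣ,
-- where ⁻ deletes a fixed p-formula P on one side, σ is a position map
-- compatible with the modal rules and Eₗ, Eᵣ are extra side formulas.  Every
-- rule not introducing P is copied (a □R/◇L step first gets a fresh
-- eigen-token by height-preserving renaming); rules introducing P are passed
-- to a handler.  Three families of instances give the theorem:
--   * substitution of positions α∘x ↦ α++β is admissible (no deletion),
--   * the right rules ¬R ∧R ∨R ⇒R □R and the left rule ◇L are invertible
--     without raising the degree,
--   * the mix on P: at every introduction of P in one proof we cut its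
--     premises against the inverted other proof on the immediate subformulas
--     of P, whose cuts have degree ≤ deg P = n.
-- Contexts are handled up to set inclusion, which is admissible by exchange,
-- weakening and contraction (lemma struct).

open import Defs
open import Data.Nat using (ℕ; suc; _≤_; _<_; _⊔_; z≤n; s≤s; _≟_)
open import Data.Nat.Properties using (≤-trans; ≤-refl; ≤-reflexive; m≤m⊔n; m≤n⊔m; ⊔-lub; m⊔n≤o⇒m≤o; m⊔n≤o⇒n≤o; 1+n≰n)
open import Data.List using (List; []; _∷_; _++_; [_]; map; length)
open import Data.List.Properties using (++-assoc; ++-identityʳ; map-++; map-id-local)
open import Data.List.Extrema.Nat using (max; v≤max⁺)
open import Data.List.Membership.Propositional using (_∈_; _∉_; lose)
open import Data.List.Membership.Propositional.Properties using (∈-∃++; ∈-++⁺ˡ; ∈-++⁺ʳ; ∈-++⁻; ∈-map⁺; ∈-map⁻)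
open import Data.List.Relation.Binary.Subset.Propositional using (_⊆_)
open import Data.List.Relation.Binary.Subset.Propositional.Properties using (⊆-refl; ∈-∷⁺ʳ; Any-resp-⊆; xs⊆xs++ys; xs⊆ys++xs)
open import Data.List.Relation.Unary.Any using (here; there)
open import Data.List.Relation.Unary.All using (tabulate)
open import Data.List.Relation.Binary.Permutation.Propositional using (_↭_; prep; swap; ↭-sym; ↭-trans; refl; trans; module PermutationReasoning)
open import Data.List.Relation.Binary.Permutation.Propositional.Properties using (shift; ++-comm)
open import Data.Product using (Σ; _×_; _,_; proj₁)
open import Data.Sum using (_⊎_; inj₁; inj₂; [_,_]′)
open import Data.Empty using (⊥; ⊥-elim)
open import Data.Unit using (⊤; tt)
open import Data.Maybe using (Maybe; just; nothing)
open import Data.Maybe.Properties using (≡-dec)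
open import Relation.Nullary using (¬_; Dec; yes; no)
open import Relation.Binary.PropositionalEquality using (_≡_; refl; sym; cong; cong₂; subst; _≢_)
  renaming (trans to ≡-trans)

module _ {A : Set} where
  []⊆ : {Y : List A} → [] ⊆ Y
  []⊆ ()

  ++⊆ : {X Y Z : List A} → X ⊆ Z → Y ⊆ Z → X ++ Y ⊆ Z
  ++⊆ {X} s t q = [ s , t ]′ (∈-++⁻ X q)

  ∈-snoc⁻ : ∀ {x a : A} X → x ∈ X ++ [ a ] → x ∈ X ⊎ x ≡ a
  ∈-snoc⁻ X q with ∈-++⁻ X q
  ... | inj₁ p = inj₁ p
  ... | inj₂ (here e) = inj₂ e

  ∈-snoc : ∀ {a : A} X → a ∈ X ++ [ a ]
  ∈-snoc X = ∈-++⁺ʳ X (here refl)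

Prv : System → List PFormula → List PFormula → ℕ → Set
Prv S Γ Δ n = Σ (Proof S Γ Δ) (λ π → g π ≤ n)

castPrv : ∀ {S Γ Γ' Δ Δ' n} → Γ ≡ Γ' → Δ ≡ Δ' → Prv S Γ Δ n → Prv S Γ' Δ' n
castPrv refl refl p = p

-- Exchange makes arbitrary permutations of either side admissible.  The
-- prefix Ξ records the part of the context already put in order.
permL-after : ∀ {S Γ Γ' Δ n} Ξ → Γ ↭ Γ' → Prv S (Ξ ++ Γ) Δ n → Prv S (Ξ ++ Γ') Δ n
permL-after Ξ refl p = p
permL-after {Γ = x ∷ Γ} {x ∷ Γ'} Ξ (prep x q) p =
  castPrv (++-assoc Ξ [ x ] Γ') refl
    (permL-after (Ξ ++ [ x ]) q (castPrv (sym (++-assoc Ξ [ x ] Γ)) refl p))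
permL-after {Γ = x ∷ y ∷ Γ} {y ∷ x ∷ Γ'} Ξ (swap x y q) (π , d) =
  castPrv (++-assoc Ξ (y ∷ x ∷ []) Γ') refl
    (permL-after (Ξ ++ y ∷ x ∷ []) q
      (castPrv (sym (++-assoc Ξ (y ∷ x ∷ []) Γ)) refl (eL {Γ₁ = Ξ} {Γ₂ = Γ} x y π , d)))
permL-after Ξ (trans q r) p = permL-after Ξ r (permL-after Ξ q p)

permL : ∀ {S Γ Γ' Δ n} → Γ ↭ Γ' → Prv S Γ Δ n → Prv S Γ' Δ n
permL = permL-after []

permR-after : ∀ {S Γ Δ Δ' n} Ξ → Δ ↭ Δ' → Prv S Γ (Ξ ++ Δ) n → Prv S Γ (Ξ ++ Δ') n
permR-after Ξ refl p = p
permR-after {Δ = x ∷ Δ} {x ∷ Δ'} Ξ (prep x q) p =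
  castPrv refl (++-assoc Ξ [ x ] Δ')
    (permR-after (Ξ ++ [ x ]) q (castPrv refl (sym (++-assoc Ξ [ x ] Δ)) p))
permR-after {Δ = x ∷ y ∷ Δ} {y ∷ x ∷ Δ'} Ξ (swap x y q) (π , d) =
  castPrv refl (++-assoc Ξ (y ∷ x ∷ []) Δ')
    (permR-after (Ξ ++ y ∷ x ∷ []) q
      (castPrv refl (sym (++-assoc Ξ (y ∷ x ∷ []) Δ)) (eR {Δ₁ = Ξ} {Δ₂ = Δ} x y π , d)))
permR-after Ξ (trans q r) p = permR-after Ξ r (permR-after Ξ q p)

permR : ∀ {S Γ Δ Δ' n} → Δ ↭ Δ' → Prv S Γ Δ n → Prv S Γ Δ' n
permR = permR-after []

weakenL : ∀ {S Γ Δ n} W → Prv S Γ Δ n → Prv S (Γ ++ W) Δ n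
weakenL {Γ = Γ} [] p = castPrv (sym (++-identityʳ Γ)) refl p
weakenL {Γ = Γ} (x ∷ W) (π , d) = castPrv (++-assoc Γ [ x ] W) refl (weakenL W (wL x π , d))

weakenR : ∀ {S Γ Δ n} W → Prv S Γ Δ n → Prv S Γ (W ++ Δ) n
weakenR [] p = p
weakenR (x ∷ W) p with weakenR W p
... | π , d = wR x π , d

-- The permutations used for contraction: the extra copy of a at the end is
-- brought next to an occurrence of a, and taken back.
pairUp : ∀ (a : PFormula) ys zs → (ys ++ a ∷ zs) ++ [ a ] ↭ (ys ++ zs) ++ a ∷ a ∷ []
pairUp a ys zs = begin
  (ys ++ a ∷ zs) ++ [ a ]         ≡⟨ ++-assoc ys (a ∷ zs) [ a ] ⟩
  ys ++ a ∷ zs ++ [ a ]           ↭⟨ shift a ys (zs ++ [ a ]) ⟩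
  a ∷ ys ++ zs ++ [ a ]           ≡⟨ cong (a ∷_) (sym (++-assoc ys zs [ a ])) ⟩
  a ∷ (ys ++ zs) ++ [ a ]         ↭⟨ ++-comm [ a ] ((ys ++ zs) ++ [ a ]) ⟩
  ((ys ++ zs) ++ [ a ]) ++ [ a ]  ≡⟨ ++-assoc (ys ++ zs) [ a ] [ a ] ⟩
  (ys ++ zs) ++ a ∷ a ∷ []        ∎
  where open PermutationReasoning

unpair : ∀ (a : PFormula) ys zs → (ys ++ zs) ++ [ a ] ↭ ys ++ a ∷ zs
unpair a ys zs = ↭-trans (++-comm (ys ++ zs) [ a ]) (↭-sym (shift a ys zs))

contractL : ∀ {S Γ Δ n a} → a ∈ Γ → Prv S (Γ ++ [ a ]) Δ n → Prv S Γ Δ n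
contractL {a = a} a∈Γ p with ∈-∃++ a∈Γ
... | ys , zs , refl with permL (pairUp a ys zs) p
... | π , d = permL (unpair a ys zs) (cL {Γ = ys ++ zs} a π , d)

contractR : ∀ {S Γ Δ n a} → a ∈ Δ → Prv S Γ (a ∷ Δ) n → Prv S Γ Δ n
contractR {a = a} a∈Δ p with ∈-∃++ a∈Δ
... | ys , zs , refl with permR (prep a (shift a ys zs)) p
... | π , d = permR (↭-sym (shift a ys zs)) (cR a π , d)

absorbL : ∀ {S Ξ Δ n} R → R ⊆ Ξ → Prv S (Ξ ++ R) Δ n → Prv S Ξ Δ n
absorbL {Ξ = Ξ} [] s p = castPrv (++-identityʳ Ξ) refl p
absorbL {Ξ = Ξ} (a ∷ R) s p =
  absorbL R (λ q → s (there q)) (contractL (∈-++⁺ˡ (s (here refl))) (permL toEnd p))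
  where
  toEnd : Ξ ++ a ∷ R ↭ (Ξ ++ R) ++ [ a ]
  toEnd = ↭-trans (shift a Ξ R) (++-comm [ a ] (Ξ ++ R))

absorbR : ∀ {S Γ Ξ n} R → R ⊆ Ξ → Prv S Γ (Ξ ++ R) n → Prv S Γ Ξ n
absorbR {Ξ = Ξ} [] s p = castPrv refl (++-identityʳ Ξ) p
absorbR {Ξ = Ξ} (a ∷ R) s p =
  absorbR R (λ q → s (there q)) (contractR (∈-++⁺ˡ (s (here refl))) (permR (shift a Ξ R) p))

structL : ∀ {S Γ Γ' Δ n} → Γ ⊆ Γ' → Prv S Γ Δ n → Prv S Γ' Δ n
structL {Γ = Γ} {Γ'} s p = absorbL Γ s (permL (++-comm Γ Γ') (weakenL Γ' p))

structR : ∀ {S Γ Δ Δ' n} → Δ ⊆ Δ' → Prv S Γ Δ n → Prv S Γ Δ' n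
structR {Δ = Δ} {Δ'} s p = absorbR Δ s (weakenR Δ' p)

struct : ∀ {S Γ Γ' Δ Δ' n} → Γ ⊆ Γ' → Δ ⊆ Δ' → Prv S Γ Δ n → Prv S Γ' Δ' n
struct s t p = structR t (structL s p)

module _ {A : Set} where
  ⊆-∷⇒snoc : {X₀ X : List A} {a : A} → X₀ ⊆ a ∷ X → X₀ ⊆ X ++ [ a ]
  ⊆-∷⇒snoc {X = X} s q with s q
  ... | here refl = ∈-snoc X
  ... | there r = ∈-++⁺ˡ r

  snoc⊆ : {X : List A} {a : A} → a ∈ X → X ++ [ a ] ⊆ X
  snoc⊆ m = ++⊆ ⊆-refl (∈-∷⁺ʳ m []⊆)

  dup⊆ : {X : List A} → X ++ X ⊆ X
  dup⊆ = ++⊆ ⊆-refl ⊆-refl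

-- Each rule with its premises given up to inclusion: a premise proves any
-- sequent whose sides are included in the conclusion's sides extended by the
-- active formula, and the principal formula need only occur in the
-- conclusion.
module Rules⊆ {S : System} {n : ℕ} where
  ax⊆ : ∀ {X Y} Q → Q ∈ X → Q ∈ Y → Prv S X Y n
  ax⊆ Q a b = struct (∈-∷⁺ʳ a []⊆) (∈-∷⁺ʳ b []⊆) (ax Q , z≤n)

  cut⊆ : ∀ {X Y X₁ Y₁ X₂ Y₂} Q → suc (pdeg Q) ≤ n → Prv S X₁ Y₁ n → Prv S X₂ Y₂ n →
         X₁ ⊆ X → X₂ ⊆ (Q ∷ X) → Y₁ ⊆ (Q ∷ Y) → Y₂ ⊆ Y → Prv S X Y n
  cut⊆ Q d p1 p2 a b c e with struct a c p1 | struct (⊆-∷⇒snoc b) e p2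
  ... | (π₁ , d₁) | (π₂ , d₂) = struct dup⊆ dup⊆ (cut Q π₁ π₂ , ⊔-lub d (⊔-lub d₁ d₂))

  ¬L⊆ : ∀ {X Y X₀ Y₀} A α → Prv S X₀ Y₀ n → X₀ ⊆ X → Y₀ ⊆ ((A ^ α) ∷ Y) → ((¬ᶠ A) ^ α) ∈ X → Prv S X Y n
  ¬L⊆ A α p a b m with struct a b p
  ... | (π , d) = structL (snoc⊆ m) (¬L A α π , d)

  ¬R⊆ : ∀ {X Y X₀ Y₀} A α → Prv S X₀ Y₀ n → X₀ ⊆ ((A ^ α) ∷ X) → Y₀ ⊆ Y → ((¬ᶠ A) ^ α) ∈ Y → Prv S X Y n
  ¬R⊆ A α p a b m with struct (⊆-∷⇒snoc a) b p
  ... | (π , d) = structR (∈-∷⁺ʳ m ⊆-refl) (¬R A α π , d)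

  ∧L₁⊆ : ∀ {X Y X₀ Y₀} A B α → Prv S X₀ Y₀ n → X₀ ⊆ ((A ^ α) ∷ X) → Y₀ ⊆ Y → ((A ∧ᶠ B) ^ α) ∈ X → Prv S X Y n
  ∧L₁⊆ A B α p a b m with struct (⊆-∷⇒snoc a) b p
  ... | (π , d) = structL (snoc⊆ m) (∧L₁ A B α π , d)

  ∧L₂⊆ : ∀ {X Y X₀ Y₀} A B α → Prv S X₀ Y₀ n → X₀ ⊆ ((B ^ α) ∷ X) → Y₀ ⊆ Y → ((A ∧ᶠ B) ^ α) ∈ X → Prv S X Y n
  ∧L₂⊆ A B α p a b m with struct (⊆-∷⇒snoc a) b p
  ... | (π , d) = structL (snoc⊆ m) (∧L₂ A B α π , d)

  ∧R⊆ : ∀ {X Y X₁ Y₁ X₂ Y₂} A B α → Prv S X₁ Y₁ n → Prv S X₂ Y₂ n →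
        X₁ ⊆ X → X₂ ⊆ X → Y₁ ⊆ ((A ^ α) ∷ Y) → Y₂ ⊆ ((B ^ α) ∷ Y) → ((A ∧ᶠ B) ^ α) ∈ Y → Prv S X Y n
  ∧R⊆ A B α p1 p2 a b c e m with struct a c p1 | struct b e p2
  ... | (π₁ , d₁) | (π₂ , d₂) = struct dup⊆ (∈-∷⁺ʳ m dup⊆) (∧R A B α π₁ π₂ , ⊔-lub d₁ d₂)

  ∨L⊆ : ∀ {X Y X₁ Y₁ X₂ Y₂} A B α → Prv S X₁ Y₁ n → Prv S X₂ Y₂ n →
        X₁ ⊆ ((A ^ α) ∷ X) → X₂ ⊆ ((B ^ α) ∷ X) → Y₁ ⊆ Y → Y₂ ⊆ Y → ((A ∨ᶠ B) ^ α) ∈ X → Prv S X Y n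
  ∨L⊆ {X} A B α p1 p2 a b c e m with struct (⊆-∷⇒snoc a) c p1 | struct (⊆-∷⇒snoc b) e p2
  ... | (π₁ , d₁) | (π₂ , d₂) =
    struct (++⊆ ⊆-refl (++⊆ ⊆-refl (∈-∷⁺ʳ m []⊆))) dup⊆ (∨L {Γ₁ = X} {Γ₂ = X} A B α π₁ π₂ , ⊔-lub d₁ d₂)

  ∨R₁⊆ : ∀ {X Y X₀ Y₀} A B α → Prv S X₀ Y₀ n → X₀ ⊆ X → Y₀ ⊆ ((A ^ α) ∷ Y) → ((A ∨ᶠ B) ^ α) ∈ Y → Prv S X Y n
  ∨R₁⊆ A B α p a b m with struct a b p
  ... | (π , d) = structR (∈-∷⁺ʳ m ⊆-refl) (∨R₁ A B α π , d)

  ∨R₂⊆ : ∀ {X Y X₀ Y₀} A B α → Prv S X₀ Y₀ n → X₀ ⊆ X → Y₀ ⊆ ((B ^ α) ∷ Y) → ((A ∨ᶠ B) ^ α) ∈ Y → Prv S X Y n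
  ∨R₂⊆ A B α p a b m with struct a b p
  ... | (π , d) = structR (∈-∷⁺ʳ m ⊆-refl) (∨R₂ A B α π , d)

  ⇒L⊆ : ∀ {X Y X₁ Y₁ X₂ Y₂} A B α → Prv S X₁ Y₁ n → Prv S X₂ Y₂ n →
        X₁ ⊆ X → Y₁ ⊆ ((A ^ α) ∷ Y) → X₂ ⊆ ((B ^ α) ∷ X) → Y₂ ⊆ Y → ((A ⇒ᶠ B) ^ α) ∈ X → Prv S X Y n
  ⇒L⊆ {X} A B α p1 p2 a b c e m with struct a b p1 | struct (⊆-∷⇒snoc c) e p2
  ... | (π₁ , d₁) | (π₂ , d₂) =
    struct (++⊆ ⊆-refl (++⊆ ⊆-refl (∈-∷⁺ʳ m []⊆))) dup⊆ (⇒L {Γ₁ = X} {Γ₂ = X} A B α π₁ π₂ , ⊔-lub d₁ d₂)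

  ⇒R⊆ : ∀ {X Y X₀ Y₀} A B α → Prv S X₀ Y₀ n →
        X₀ ⊆ ((A ^ α) ∷ X) → Y₀ ⊆ ((B ^ α) ∷ Y) → ((A ⇒ᶠ B) ^ α) ∈ Y → Prv S X Y n
  ⇒R⊆ A B α p a b m with struct (⊆-∷⇒snoc a) b p
  ... | (π , d) = structR (∈-∷⁺ʳ m ⊆-refl) (⇒R A B α π , d)

  □L⊆ : ∀ {X Y X₀ Y₀} A α β → Allowed S β → Prv S X₀ Y₀ n →
        X₀ ⊆ ((A ^ (α ++ β)) ∷ X) → Y₀ ⊆ Y → ((□ A) ^ α) ∈ X → Prv S X Y n
  □L⊆ A α β al p a b m with struct (⊆-∷⇒snoc a) b p
  ... | (π , d) = structL (snoc⊆ m) (□L A α β al π , d)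

  ◇R⊆ : ∀ {X Y X₀ Y₀} A α β → Allowed S β → Prv S X₀ Y₀ n →
        X₀ ⊆ X → Y₀ ⊆ ((A ^ (α ++ β)) ∷ Y) → ((◇ A) ^ α) ∈ Y → Prv S X Y n
  ◇R⊆ A α β al p a b m with struct a b p
  ... | (π , d) = structR (∈-∷⁺ʳ m ⊆-refl) (◇R A α β al π , d)

  □R⊆ : ∀ {X Y X₀ Y₀} A α x → ¬ ((α ∘ₜ x) ∈I (X ++ Y)) → Prv S X₀ Y₀ n →
        X₀ ⊆ X → Y₀ ⊆ ((A ^ (α ∘ₜ x)) ∷ Y) → ((□ A) ^ α) ∈ Y → Prv S X Y n
  □R⊆ A α x c p a b m with struct a b p
  ... | (π , d) = structR (∈-∷⁺ʳ m ⊆-refl) (□R A α x c π , d)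

  ◇L⊆ : ∀ {X Y X₀ Y₀} A α x → ¬ ((α ∘ₜ x) ∈I (X ++ Y)) → Prv S X₀ Y₀ n →
        X₀ ⊆ ((A ^ (α ∘ₜ x)) ∷ X) → Y₀ ⊆ Y → ((◇ A) ^ α) ∈ X → Prv S X Y n
  ◇L⊆ A α x c p a b m with struct (⊆-∷⇒snoc a) b p
  ... | (π , d) = structL (snoc⊆ m) (◇L A α x c π , d)

-- The traversals below recurse on the height of a proof rather than on its
-- structure: a □R/◇L premise is first renamed to a fresh eigen-token, which
-- gives a proof of the same height that is not a subterm.
ht : ∀ {S Γ Δ} → Proof S Γ Δ → ℕ
ht (ax _) = 1
ht (cut _ π π′) = suc (ht π ⊔ ht π′)
ht (wL _ π) = suc (ht π)
ht (wR _ π) = suc (ht π)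
ht (cL _ π) = suc (ht π)
ht (cR _ π) = suc (ht π)
ht (eL _ _ π) = suc (ht π)
ht (eR _ _ π) = suc (ht π)
ht (¬L _ _ π) = suc (ht π)
ht (¬R _ _ π) = suc (ht π)
ht (∧L₁ _ _ _ π) = suc (ht π)
ht (∧L₂ _ _ _ π) = suc (ht π)
ht (∧R _ _ _ π π′) = suc (ht π ⊔ ht π′)
ht (∨L _ _ _ π π′) = suc (ht π ⊔ ht π′)
ht (∨R₁ _ _ _ π) = suc (ht π)
ht (∨R₂ _ _ _ π) = suc (ht π)
ht (⇒L _ _ _ π π′) = suc (ht π ⊔ ht π′)
ht (⇒R _ _ _ π) = suc (ht π)
ht (□L _ _ _ _ π) = suc (ht π)
ht (□R _ _ _ _ π) = suc (ht π)
ht (◇L _ _ _ _ π) = suc (ht π)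
ht (◇R _ _ _ _ π) = suc (ht π)

tokens : List PFormula → List Token
tokens [] = []
tokens (Q ∷ Γ) = pos Q ++ tokens Γ

∈-tokens : ∀ {t Q} Γ → Q ∈ Γ → t ∈ pos Q → t ∈ tokens Γ
∈-tokens (Q ∷ Γ) (here refl) t = ∈-++⁺ˡ t
∈-tokens (R ∷ Γ) (there q) t = ∈-++⁺ʳ (pos R) (∈-tokens Γ q t)

-- Tokens are natural numbers, so one above the maximum is fresh for a
-- context W and a list ts of further tokens.
freshFor : (W : List PFormula) (ts : List Token) →
           Σ Token (λ y → (∀ {Q} → Q ∈ W → y ∉ pos Q) × y ∉ ts)
freshFor W ts = y , (λ q t → y∉used (∈-++⁺ˡ (∈-tokens W q t))) , (λ t → y∉used (∈-++⁺ʳ (tokens W) t))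
  where
  used : List Token
  used = tokens W ++ ts
  y : Token
  y = suc (max 0 used)
  y∉used : y ∉ used
  y∉used y∈ = 1+n≰n (v≤max⁺ 0 used (inj₂ (lose y∈ ≤-refl)))

-- A position δ∘y lies below a p-formula only if y occurs in its position,
-- so a fresh token satisfies the eigen-token condition of □R and ◇L.
∘ₜ-⪯⇒∈ : ∀ {δ z ε} → (δ ∘ₜ z) ⪯ ε → z ∈ ε
∘ₜ-⪯⇒∈ {δ} {z} (γ , refl) = subst (z ∈_) (sym (++-assoc δ [ z ] γ)) (∈-++⁺ʳ δ (here refl))

fresh∉I : ∀ {δ y} L → (∀ {Q} → Q ∈ L → y ∉ pos Q) → ¬ ((δ ∘ₜ y) ∈I L)
fresh∉I (Q ∷ L) fr (here p) = fr (here refl) (∘ₜ-⪯⇒∈ p)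
fresh∉I (Q ∷ L) fr (there q) = fresh∉I L (λ m → fr (there m)) q

∉I-mono : ∀ {δ L L'} → L ⊆ L' → ¬ (δ ∈I L') → ¬ (δ ∈I L)
∉I-mono s c q = c (Any-resp-⊆ s q)

Allowed-len : ∀ S {β β'} → length β' ≡ length β → Allowed S β → Allowed S β'
Allowed-len 2D e a = ≡-trans e a
Allowed-len 2T e a = subst (_≤ 1) (sym e) a
Allowed-len 2S4 e a = tt

-- Such maps preserve
-- all rules, including the restrictions on β and the eigen-token conditions.
record Renaming : Set where
  field
    ρ : Position → Position
    ρ-involutive : ∀ δ → ρ (ρ δ) ≡ δ
    ρ-extends : ∀ δ γ → Σ Position (λ γ' → (ρ (δ ++ γ) ≡ ρ δ ++ γ') × (length γ' ≡ length γ))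

module RenameProofs (R : Renaming) where
  open Renaming R

  ρᴾ : PFormula → PFormula
  ρᴾ (A ^ δ) = A ^ ρ δ

  ρᶜ : List PFormula → List PFormula
  ρᶜ = map ρᴾ

  -- ρ reflects prefixes, hence preserves "δ ∉ I(Γ)".
  ρ-⪯ : ∀ {u ε} → u ⪯ ρ ε → ρ u ⪯ ε
  ρ-⪯ {u} {ε} (γ , e) with ρ-extends u γ
  ... | γ' , e' , _ = γ' , ≡-trans (sym e') (≡-trans (cong ρ e) (ρ-involutive ε))

  -- ρ sends the position one token below δ to one token below ρ δ, which
  -- is how eigen-tokens are renamed.
  ρ-∘ₜ : ∀ δ z → Σ Token (λ z' → ρ (δ ∘ₜ z) ≡ ρ δ ∘ₜ z')
  ρ-∘ₜ δ z with ρ-extends δ [ z ]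
  ... | (z' ∷ []) , e , _ = z' , e

  ρ-eigen : ∀ {δ z z' Γ} → ρ (δ ∘ₜ z) ≡ ρ δ ∘ₜ z' → ¬ ((δ ∘ₜ z) ∈I Γ) → ¬ ((ρ δ ∘ₜ z') ∈I ρᶜ Γ)
  ρ-eigen {Γ = Q ∷ Γ} e c (here p) = c (here (subst (λ u → u ⪯ pos Q) (≡-trans (cong ρ (sym e)) (ρ-involutive _)) (ρ-⪯ p)))
  ρ-eigen {Γ = Q ∷ Γ} e c (there q) = ρ-eigen e (λ r → c (there r)) q

  SameShape : ∀ {S Γ Δ} → Proof S Γ Δ → Set
  SameShape {S} {Γ} {Δ} π = Σ (Proof S (ρᶜ Γ) (ρᶜ Δ)) (λ π' → (g π' ≡ g π) × (ht π' ≡ ht π))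

  ρᶜ-snoc : ∀ Γ Q → ρᶜ (Γ ++ [ Q ]) ≡ ρᶜ Γ ++ [ ρᴾ Q ]
  ρᶜ-snoc Γ Q = map-++ ρᴾ Γ [ Q ]

  recast : ∀ {S Γ Γ' Δ Δ'} {a b : ℕ} (p : Γ ≡ Γ') (q : Δ ≡ Δ') (π : Proof S Γ Δ) → g π ≡ a → ht π ≡ b →
       Σ (Proof S Γ' Δ') (λ π' → (g π' ≡ a) × (ht π' ≡ b))
  recast refl refl π x y = π , x , y

  rename : ∀ {S Γ Δ} (π : Proof S Γ Δ) → SameShape π
  rename (ax P) = ax (ρᴾ P) , refl , refl
  rename (cut {Γ₁} {Δ₁} {Γ₂} {Δ₂} P π₁ π₂) with rename π₁ | rename π₂
  ... | π₁' , g1 , h1 | π₂' , g2 , h2 with recast (ρᶜ-snoc Γ₂ P) refl π₂' g2 h2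
  ... | π₂'' , g3 , h3 = recast (sym (map-++ ρᴾ Γ₁ Γ₂)) (sym (map-++ ρᴾ Δ₁ Δ₂)) (cut (ρᴾ P) π₁' π₂'')
          (cong₂ (λ a b → suc (pdeg P) ⊔ (a ⊔ b)) g1 g3) (cong₂ (λ a b → suc (a ⊔ b)) h1 h3)
  rename (wL {Γ} P π) with rename π
  ... | π' , g1 , h1 = recast (sym (ρᶜ-snoc Γ P)) refl (wL (ρᴾ P) π') g1 (cong suc h1)
  rename (wR P π) with rename π
  ... | π' , g1 , h1 = wR (ρᴾ P) π' , g1 , cong suc h1
  rename (cL {Γ} P π) with rename π
  ... | π' , g1 , h1 with recast (map-++ ρᴾ Γ (P ∷ P ∷ [])) refl π' g1 h1
  ... | π'' , g2 , h2 = recast (sym (ρᶜ-snoc Γ P)) refl (cL (ρᴾ P) π'') g2 (cong suc h2)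
  rename (cR P π) with rename π
  ... | π' , g1 , h1 = cR (ρᴾ P) π' , g1 , cong suc h1
  rename (eL {Γ₁} {Γ₂} P Q π) with rename π
  ... | π' , g1 , h1 with recast (map-++ ρᴾ Γ₁ (P ∷ Q ∷ Γ₂)) refl π' g1 h1
  ... | π'' , g2 , h2 = recast (sym (map-++ ρᴾ Γ₁ (Q ∷ P ∷ Γ₂))) refl (eL (ρᴾ P) (ρᴾ Q) π'') g2 (cong suc h2)
  rename (eR {Γ} {Δ₁} {Δ₂} P Q π) with rename π
  ... | π' , g1 , h1 with recast refl (map-++ ρᴾ Δ₁ (P ∷ Q ∷ Δ₂)) π' g1 h1
  ... | π'' , g2 , h2 = recast refl (sym (map-++ ρᴾ Δ₁ (Q ∷ P ∷ Δ₂))) (eR (ρᴾ P) (ρᴾ Q) π'') g2 (cong suc h2)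
  rename (¬L {Γ} A α π) with rename π
  ... | π' , g1 , h1 = recast (sym (ρᶜ-snoc Γ _)) refl (¬L A (ρ α) π') g1 (cong suc h1)
  rename (¬R {Γ} A α π) with rename π
  ... | π' , g1 , h1 with recast (ρᶜ-snoc Γ _) refl π' g1 h1
  ... | π'' , g2 , h2 = ¬R A (ρ α) π'' , g2 , cong suc h2
  rename (∧L₁ {Γ} A B α π) with rename π
  ... | π' , g1 , h1 with recast (ρᶜ-snoc Γ _) refl π' g1 h1
  ... | π'' , g2 , h2 = recast (sym (ρᶜ-snoc Γ _)) refl (∧L₁ A B (ρ α) π'') g2 (cong suc h2)
  rename (∧L₂ {Γ} A B α π) with rename π
  ... | π' , g1 , h1 with recast (ρᶜ-snoc Γ _) refl π' g1 h1
  ... | π'' , g2 , h2 = recast (sym (ρᶜ-snoc Γ _)) refl (∧L₂ A B (ρ α) π'') g2 (cong suc h2)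
  rename (∧R {Γ₁} {Δ₁} {Γ₂} {Δ₂} A B α π₁ π₂) with rename π₁ | rename π₂
  ... | π₁' , g1 , h1 | π₂' , g2 , h2 =
    recast (sym (map-++ ρᴾ Γ₁ Γ₂)) (cong (_ ∷_) (sym (map-++ ρᴾ Δ₁ Δ₂))) (∧R A B (ρ α) π₁' π₂')
      (cong₂ _⊔_ g1 g2) (cong₂ (λ a b → suc (a ⊔ b)) h1 h2)
  rename (∨L {Γ₁} {Δ₁} {Γ₂} {Δ₂} A B α π₁ π₂) with rename π₁ | rename π₂
  ... | π₁' , g1 , h1 | π₂' , g2 , h2 with recast (ρᶜ-snoc Γ₁ _) refl π₁' g1 h1 | recast (ρᶜ-snoc Γ₂ _) refl π₂' g2 h2
  ... | π₁'' , g3 , h3 | π₂'' , g4 , h4 =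
    recast (≡-trans (cong (λ l → ρᶜ Γ₁ ++ l) (sym (ρᶜ-snoc Γ₂ _))) (sym (map-++ ρᴾ Γ₁ (Γ₂ ++ _)))) (sym (map-++ ρᴾ Δ₁ Δ₂))
      (∨L A B (ρ α) π₁'' π₂'') (cong₂ _⊔_ g3 g4) (cong₂ (λ a b → suc (a ⊔ b)) h3 h4)
  rename (∨R₁ A B α π) with rename π
  ... | π' , g1 , h1 = ∨R₁ A B (ρ α) π' , g1 , cong suc h1
  rename (∨R₂ A B α π) with rename π
  ... | π' , g1 , h1 = ∨R₂ A B (ρ α) π' , g1 , cong suc h1
  rename (⇒L {Γ₁} {Δ₁} {Γ₂} {Δ₂} A B α π₁ π₂) with rename π₁ | rename π₂
  ... | π₁' , g1 , h1 | π₂' , g2 , h2 with recast (ρᶜ-snoc Γ₂ _) refl π₂' g2 h2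
  ... | π₂'' , g4 , h4 =
    recast (≡-trans (cong (λ l → ρᶜ Γ₁ ++ l) (sym (ρᶜ-snoc Γ₂ _))) (sym (map-++ ρᴾ Γ₁ (Γ₂ ++ _)))) (sym (map-++ ρᴾ Δ₁ Δ₂))
      (⇒L A B (ρ α) π₁' π₂'') (cong₂ _⊔_ g1 g4) (cong₂ (λ a b → suc (a ⊔ b)) h1 h4)
  rename (⇒R {Γ} A B α π) with rename π
  ... | π' , g1 , h1 with recast (ρᶜ-snoc Γ _) refl π' g1 h1
  ... | π'' , g2 , h2 = ⇒R A B (ρ α) π'' , g2 , cong suc h2
  rename {S} (□L {Γ} A α β al π) with rename π | ρ-extends α β
  ... | π' , g1 , h1 | β' , e , le with recast (≡-trans (ρᶜ-snoc Γ _) (cong (λ u → ρᶜ Γ ++ [ A ^ u ]) e)) refl π' g1 h1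
  ... | π'' , g2 , h2 = recast (sym (ρᶜ-snoc Γ _)) refl (□L A (ρ α) β' (Allowed-len S le al) π'') g2 (cong suc h2)
  rename {S} (◇R A α β al π) with rename π | ρ-extends α β
  ... | π' , g1 , h1 | β' , e , le with recast refl (cong (λ u → (A ^ u) ∷ _) e) π' g1 h1
  ... | π'' , g2 , h2 = ◇R A (ρ α) β' (Allowed-len S le al) π'' , g2 , cong suc h2
  rename (□R {Γ} {Δ} A α x c π) with rename π | ρ-∘ₜ α x
  ... | π' , g1 , h1 | x' , e with recast refl (cong (λ u → (A ^ u) ∷ _) e) π' g1 h1
  ... | π'' , g2 , h2 =
    □R A (ρ α) x' (λ q → ρ-eigen {Γ = Γ ++ Δ} e c (subst (λ l → (ρ α ∘ₜ x') ∈I l) (sym (map-++ ρᴾ Γ Δ)) q)) π'' ,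
    g2 , cong suc h2
  rename (◇L {Γ} {Δ} A α x c π) with rename π | ρ-∘ₜ α x
  ... | π' , g1 , h1 | x' , e with recast (≡-trans (ρᶜ-snoc Γ _) (cong (λ u → ρᶜ Γ ++ [ A ^ u ]) e)) refl π' g1 h1
  ... | π'' , g2 , h2 =
    recast (sym (ρᶜ-snoc Γ _)) refl
      (◇L A (ρ α) x' (λ q → ρ-eigen {Γ = Γ ++ Δ} e c (subst (λ l → (ρ α ∘ₜ x') ∈I l) (sym (map-++ ρᴾ Γ Δ)) q)) π'')
      g2 (cong suc h2)

swapTok : Token → Token → Token → Token
swapTok x y z with z ≟ x
... | yes _ = y
... | no _ with z ≟ y
...   | yes _ = x
...   | no _ = z

swapTok-x : ∀ x y → swapTok x y x ≡ y
swapTok-x x y with x ≟ x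
... | yes _ = refl
... | no ne = ⊥-elim (ne refl)

swapTok-y : ∀ x y → swapTok x y y ≡ x
swapTok-y x y with y ≟ x
... | yes e = e
... | no _ with y ≟ y
...   | yes _ = refl
...   | no ne = ⊥-elim (ne refl)

swapTok-other : ∀ x y z → z ≢ x → z ≢ y → swapTok x y z ≡ z
swapTok-other x y z n1 n2 with z ≟ x
... | yes e = ⊥-elim (n1 e)
... | no _ with z ≟ y
...   | yes e = ⊥-elim (n2 e)
...   | no _ = refl

swapTok-involutive : ∀ x y z → swapTok x y (swapTok x y z) ≡ z
swapTok-involutive x y z with z ≟ x
... | yes refl = swapTok-y z y
... | no n1 with z ≟ y
...   | yes refl = swapTok-x x z
...   | no n2 = swapTok-other x y z n1 n2

swapAfter : Position → Token → Token → Position → Position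
swapAfter [] x y [] = []
swapAfter [] x y (z ∷ r) = swapTok x y z ∷ r
swapAfter (a ∷ α) x y [] = []
swapAfter (a ∷ α) x y (z ∷ r) with a ≟ z
... | yes _ = z ∷ swapAfter α x y r
... | no _ = z ∷ r

swapAfter-match : ∀ a α x y z r → a ≡ z → swapAfter (a ∷ α) x y (z ∷ r) ≡ z ∷ swapAfter α x y r
swapAfter-match a α x y z r e with a ≟ z
... | yes _ = refl
... | no ne = ⊥-elim (ne e)

swapAfter-mismatch : ∀ a α x y z r → a ≢ z → swapAfter (a ∷ α) x y (z ∷ r) ≡ z ∷ r
swapAfter-mismatch a α x y z r ne with a ≟ z
... | yes e = ⊥-elim (ne e)
... | no _ = refl

swapAfter-[] : ∀ α x y → swapAfter α x y [] ≡ []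
swapAfter-[] [] x y = refl
swapAfter-[] (a ∷ α) x y = refl

swapAfter-involutive : ∀ α x y δ → swapAfter α x y (swapAfter α x y δ) ≡ δ
swapAfter-involutive [] x y [] = refl
swapAfter-involutive [] x y (z ∷ r) = cong (_∷ r) (swapTok-involutive x y z)
swapAfter-involutive (a ∷ α) x y [] = refl
swapAfter-involutive (a ∷ α) x y (z ∷ r) with a ≟ z
... | yes e = ≡-trans (swapAfter-match a α x y z _ e) (cong (z ∷_) (swapAfter-involutive α x y r))
... | no ne = swapAfter-mismatch a α x y z r ne

swapAfter-length : ∀ α x y δ → length (swapAfter α x y δ) ≡ length δ
swapAfter-length [] x y [] = refl
swapAfter-length [] x y (z ∷ r) = refl
swapAfter-length (a ∷ α) x y [] = refl
swapAfter-length (a ∷ α) x y (z ∷ r) with a ≟ z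
... | yes _ = cong suc (swapAfter-length α x y r)
... | no _ = refl

swapAfter-extends : ∀ α x y δ γ →
  Σ Position (λ γ' → (swapAfter α x y (δ ++ γ) ≡ swapAfter α x y δ ++ γ') × (length γ' ≡ length γ))
swapAfter-extends α x y [] γ =
  swapAfter α x y γ , cong (_++ swapAfter α x y γ) (sym (swapAfter-[] α x y)) , swapAfter-length α x y γ
swapAfter-extends [] x y (z ∷ δ) γ = γ , refl , refl
swapAfter-extends (a ∷ α) x y (z ∷ δ) γ with a ≟ z
... | yes _ with swapAfter-extends α x y δ γ
...   | γ' , e , l = γ' , cong (z ∷_) e , l
swapAfter-extends (a ∷ α) x y (z ∷ δ) γ | no _ = γ , refl , refl

swapRenaming : Position → Token → Token → Renaming
swapRenaming α x y = record
  { ρ = swapAfter α x y ; ρ-involutive = swapAfter-involutive α x y ; ρ-extends = swapAfter-extends α x y }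

swapAfter-hit : ∀ α x y → swapAfter α x y (α ∘ₜ x) ≡ α ∘ₜ y
swapAfter-hit [] x y = cong (_∷ []) (swapTok-x x y)
swapAfter-hit (a ∷ α) x y = ≡-trans (swapAfter-match a α x y a _ refl) (cong (a ∷_) (swapAfter-hit α x y))

swapAfter-fix : ∀ α x y δ → ¬ ((α ∘ₜ x) ⪯ δ) → ¬ ((α ∘ₜ y) ⪯ δ) → swapAfter α x y δ ≡ δ
swapAfter-fix [] x y [] n1 n2 = refl
swapAfter-fix [] x y (z ∷ r) n1 n2 = cong (_∷ r) (swapTok-other x y z (λ { refl → n1 (r , refl) }) (λ { refl → n2 (r , refl) }))
swapAfter-fix (a ∷ α) x y [] n1 n2 = refl
swapAfter-fix (a ∷ α) x y (z ∷ r) n1 n2 with a ≟ z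
... | yes refl = cong (a ∷_) (swapAfter-fix α x y r (λ { (γ , e) → n1 (γ , cong (a ∷_) e) }) (λ { (γ , e) → n2 (γ , cong (a ∷_) e) }))
... | no _ = refl

module _ (α : Position) (x y : Token) where
  open RenameProofs (swapRenaming α x y)

  swap-fixes : ∀ Γ → ¬ ((α ∘ₜ x) ∈I Γ) → ¬ ((α ∘ₜ y) ∈I Γ) → ρᶜ Γ ≡ Γ
  swap-fixes Γ c₁ c₂ = map-id-local (tabulate λ { {A ^ δ} m →
    cong (A ^_) (swapAfter-fix α x y δ (λ p → c₁ (lose m p)) (λ p → c₂ (lose m p))) })

  renameEigenR : ∀ {S Γ Δ A} → ¬ ((α ∘ₜ x) ∈I (Γ ++ Δ)) → ¬ ((α ∘ₜ y) ∈I (Γ ++ Δ)) →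
    (π : Proof S Γ ((A ^ (α ∘ₜ x)) ∷ Δ)) →
    Σ (Proof S Γ ((A ^ (α ∘ₜ y)) ∷ Δ)) (λ π' → (g π' ≡ g π) × (ht π' ≡ ht π))
  renameEigenR {Γ = Γ} {Δ} {A} c₁ c₂ π with rename π
  ... | π' , eg , eh = recast (fixed Γ (xs⊆xs++ys Γ Δ))
      (cong₂ (λ u v → (A ^ u) ∷ v) (swapAfter-hit α x y) (fixed Δ (xs⊆ys++xs Δ Γ))) π' eg eh
    where
    fixed : ∀ L → L ⊆ Γ ++ Δ → ρᶜ L ≡ L
    fixed L s = swap-fixes L (∉I-mono s c₁) (∉I-mono s c₂)

  renameEigenL : ∀ {S Γ Δ A} → ¬ ((α ∘ₜ x) ∈I (Γ ++ Δ)) → ¬ ((α ∘ₜ y) ∈I (Γ ++ Δ)) →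
    (π : Proof S (Γ ++ [ A ^ (α ∘ₜ x) ]) Δ) →
    Σ (Proof S (Γ ++ [ A ^ (α ∘ₜ y) ]) Δ) (λ π' → (g π' ≡ g π) × (ht π' ≡ ht π))
  renameEigenL {Γ = Γ} {Δ} {A} c₁ c₂ π with rename π
  ... | π' , eg , eh = recast
      (≡-trans (ρᶜ-snoc Γ _) (cong₂ (λ u v → u ++ [ A ^ v ]) (fixed Γ (xs⊆xs++ys Γ Δ)) (swapAfter-hit α x y)))
      (fixed Δ (xs⊆ys++xs Δ Γ)) π' eg eh
    where
    fixed : ∀ L → L ⊆ Γ ++ Δ → ρᶜ L ≡ L
    fixed L s = swap-fixes L (∉I-mono s c₁) (∉I-mono s c₂)

replaceAfter : Position → Token → Position → Position → Position
replaceAfter [] x β [] = []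
replaceAfter [] x β (z ∷ r) with z ≟ x
... | yes _ = β ++ r
... | no _ = z ∷ r
replaceAfter (a ∷ α) x β [] = []
replaceAfter (a ∷ α) x β (z ∷ r) with a ≟ z
... | yes _ = z ∷ replaceAfter α x β r
... | no _ = z ∷ r

replaceAfter-[] : ∀ α x β → replaceAfter α x β [] ≡ []
replaceAfter-[] [] x β = refl
replaceAfter-[] (a ∷ α) x β = refl

Shape : Token → Position → Position → Position → Set
Shape x β γ γ' = (γ' ≡ γ) ⊎ Σ Position (λ u → Σ Position (λ r → (γ ≡ u ++ x ∷ r) × (γ' ≡ u ++ β ++ r)))

replaceAfter-shape : ∀ α x β γ → Shape x β γ (replaceAfter α x β γ)
replaceAfter-shape [] x β [] = inj₁ refl
replaceAfter-shape [] x β (z ∷ r) with z ≟ x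
... | yes refl = inj₂ ([] , r , refl , refl)
... | no _ = inj₁ refl
replaceAfter-shape (a ∷ α) x β [] = inj₁ refl
replaceAfter-shape (a ∷ α) x β (z ∷ r) with a ≟ z
... | no _ = inj₁ refl
... | yes _ with replaceAfter-shape α x β r
...   | inj₁ e = inj₁ (cong (z ∷_) e)
...   | inj₂ (u , r' , e1 , e2) = inj₂ (z ∷ u , r' , cong (z ∷_) e1 , cong (z ∷_) e2)

replaceAfter-extends : ∀ α x β δ γ →
  Σ Position (λ γ' → (replaceAfter α x β (δ ++ γ) ≡ replaceAfter α x β δ ++ γ') × Shape x β γ γ')
replaceAfter-extends α x β [] γ =
  replaceAfter α x β γ , cong (_++ replaceAfter α x β γ) (sym (replaceAfter-[] α x β)) , replaceAfter-shape α x β γ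
replaceAfter-extends [] x β (z ∷ δ) γ with z ≟ x
... | yes _ = γ , sym (++-assoc β δ γ) , inj₁ refl
... | no _ = γ , refl , inj₁ refl
replaceAfter-extends (a ∷ α) x β (z ∷ δ) γ with a ≟ z
... | no _ = γ , refl , inj₁ refl
... | yes _ with replaceAfter-extends α x β δ γ
...   | γ' , e , s = γ' , cong (z ∷_) e , s

replaceAfter-hit : ∀ α x β → replaceAfter α x β (α ∘ₜ x) ≡ α ++ β
replaceAfter-hit [] x β with x ≟ x
... | yes _ = ++-identityʳ β
... | no ne = ⊥-elim (ne refl)
replaceAfter-hit (a ∷ α) x β with a ≟ a
... | yes _ = cong (a ∷_) (replaceAfter-hit α x β)
... | no ne = ⊥-elim (ne refl)

replaceAfter-fix : ∀ α x β δ → ¬ ((α ∘ₜ x) ⪯ δ) → replaceAfter α x β δ ≡ δ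
replaceAfter-fix [] x β [] n1 = refl
replaceAfter-fix [] x β (z ∷ r) n1 with z ≟ x
... | yes refl = ⊥-elim (n1 (r , refl))
... | no _ = refl
replaceAfter-fix (a ∷ α) x β [] n1 = refl
replaceAfter-fix (a ∷ α) x β (z ∷ r) n1 with a ≟ z
... | yes refl = cong (a ∷_) (replaceAfter-fix α x β r (λ { (γ , e) → n1 (γ , cong (a ∷_) e) }))
... | no _ = refl

-- A position map σ that can be pushed through every rule of S: it turns an
-- admitted extension β into an admitted one (□L, ◇R), commutes with
-- appending any token outside the reserved list T (□R, ◇L), and introduces
-- no tokens besides those of T (so fresh tokens stay fresh).
record PosMap (S : System) : Set where
  field
    σ : Position → Position
    T : List Token
    σ-allowed : ∀ δ β → Allowed S β → Σ Position (λ β' → (σ (δ ++ β) ≡ σ δ ++ β') × Allowed S β')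
    σ-∘ₜ : ∀ δ z → ¬ (z ∈ T) → σ (δ ∘ₜ z) ≡ σ δ ∘ₜ z
    σ-tokens : ∀ {t} ε → t ∈ σ ε → t ∈ ε ⊎ t ∈ T

-- In 2_D and 2_T an admitted extension has at most one token, so replacing
-- one of its tokens by an admitted β yields an admitted extension.
length≤1 : ∀ {A : Set} (u : List A) x r → length (u ++ x ∷ r) ≤ 1 → (u ≡ []) × (r ≡ [])
length≤1 [] x [] le = refl , refl
length≤1 [] x (_ ∷ r) (s≤s ())
length≤1 (_ ∷ []) x r (s≤s ())
length≤1 (_ ∷ _ ∷ u) x r (s≤s ())

replaceAfter-allowed : ∀ S x β γ γ' → Allowed S β → Allowed S γ → Shape x β γ γ' → Allowed S γ'
replaceAfter-allowed S x β γ γ' aβ aγ (inj₁ refl) = aγ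
replaceAfter-allowed 2S4 x β γ γ' aβ aγ (inj₂ _) = tt
replaceAfter-allowed 2D x β .(u ++ x ∷ r) .(u ++ β ++ r) aβ aγ (inj₂ (u , r , refl , refl))
  with length≤1 u x r (subst (λ k → k ≤ 1) (sym aγ) ≤-refl)
... | refl , refl = subst (λ l → length l ≡ 1) (sym (++-identityʳ β)) aβ
replaceAfter-allowed 2T x β .(u ++ x ∷ r) .(u ++ β ++ r) aβ aγ (inj₂ (u , r , refl , refl))
  with length≤1 u x r aγ
... | refl , refl = subst (λ l → length l ≤ 1) (sym (++-identityʳ β)) aβ

-- The substitution α∘x ↦ α++β, for an admitted β, is compatible with the
-- rules once x and the tokens of β are reserved.
replaceMap : ∀ S α x β → Allowed S β → PosMap S
replaceMap S α x β aβ = record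
  { σ = replaceAfter α x β
  ; T = x ∷ β
  ; σ-allowed = λ δ γ aγ → let (γ' , e , sh) = replaceAfter-extends α x β δ γ
                            in γ' , e , replaceAfter-allowed S x β γ γ' aβ aγ sh
  ; σ-∘ₜ = σ∘ₜ
  ; σ-tokens = σtokens
  }
  where
  σ∘ₜ : ∀ δ z → ¬ (z ∈ x ∷ β) → replaceAfter α x β (δ ∘ₜ z) ≡ replaceAfter α x β δ ∘ₜ z
  σ∘ₜ δ z nz with replaceAfter-extends α x β δ [ z ]
  ... | γ' , e , inj₁ refl = e
  ... | γ' , e , inj₂ ([] , r , refl , _) = ⊥-elim (nz (here refl))
  ... | γ' , e , inj₂ (_ ∷ [] , r , () , _)
  ... | γ' , e , inj₂ (_ ∷ _ ∷ u , r , () , _)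
  σtokens : ∀ {t} ε → t ∈ replaceAfter α x β ε → t ∈ ε ⊎ t ∈ x ∷ β
  σtokens {t} ε q with replaceAfter-shape α x β ε
  ... | inj₁ e = inj₁ (subst (t ∈_) e q)
  ... | inj₂ (u , r , refl , e) with ∈-++⁻ u (subst (t ∈_) e q)
  ...   | inj₁ a = inj₁ (∈-++⁺ˡ a)
  ...   | inj₂ b with ∈-++⁻ β b
  ...     | inj₁ c = inj₂ (there c)
  ...     | inj₂ d = inj₁ (∈-++⁺ʳ u (there d))

-- The traversal takes an optional position map; "nothing" is the identity
-- and, unlike the identity map, leaves contexts syntactically unchanged.
onPos : ∀ {S} → Maybe (PosMap S) → Position → Position
onPos nothing δ = δ
onPos (just G) δ = PosMap.σ G δ

onP : ∀ {S} → Maybe (PosMap S) → PFormula → PFormula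
onP m (A ^ δ) = A ^ onPos m δ

onCtx : ∀ {S} → Maybe (PosMap S) → List PFormula → List PFormula
onCtx nothing Γ = Γ
onCtx (just G) Γ = map (onP (just G)) Γ

reserved : ∀ {S} → Maybe (PosMap S) → List Token
reserved nothing = []
reserved (just G) = PosMap.T G

onCtx-∈ : ∀ {S} (m : Maybe (PosMap S)) {Q Γ} → Q ∈ Γ → onP m Q ∈ onCtx m Γ
onCtx-∈ nothing q = q
onCtx-∈ (just G) q = ∈-map⁺ (onP (just G)) q

onCtx-∈⁻ : ∀ {S} (m : Maybe (PosMap S)) {R} Γ → R ∈ onCtx m Γ → Σ PFormula (λ Q → (Q ∈ Γ) × (R ≡ onP m Q))
onCtx-∈⁻ nothing Γ q = _ , q , refl
onCtx-∈⁻ (just G) Γ q = ∈-map⁻ (onP (just G)) q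

onPos-allowed : ∀ {S} (m : Maybe (PosMap S)) δ β → Allowed S β → Σ Position (λ β' → (onPos m (δ ++ β) ≡ onPos m δ ++ β') × Allowed S β')
onPos-allowed nothing δ β a = β , refl , a
onPos-allowed (just G) δ β a = PosMap.σ-allowed G δ β a

onPos-∘ₜ : ∀ {S} (m : Maybe (PosMap S)) δ z → ¬ (z ∈ reserved m) → onPos m (δ ∘ₜ z) ≡ onPos m δ ∘ₜ z
onPos-∘ₜ nothing δ z _ = refl
onPos-∘ₜ (just G) δ z nz = PosMap.σ-∘ₜ G δ z nz

onPos-tokens : ∀ {S} (m : Maybe (PosMap S)) {t} ε → t ∈ onPos m ε → t ∈ ε ⊎ t ∈ reserved m
onPos-tokens nothing ε q = inj₁ q
onPos-tokens (just G) ε q = PosMap.σ-tokens G ε q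

∈-₋⁺ : ∀ {Q P} Γ → Q ∈ Γ → Q ≢ P → Q ∈ Γ ₋ P
∈-₋⁺ {Q} {P} (R ∷ Γ) (here refl) Q≢P with R ≟P P
... | yes e = ⊥-elim (Q≢P e)
... | no _ = here refl
∈-₋⁺ {Q} {P} (R ∷ Γ) (there q) Q≢P with R ≟P P
... | yes _ = ∈-₋⁺ Γ q Q≢P
... | no _ = there (∈-₋⁺ Γ q Q≢P)

∈-₋⁻ : ∀ {Q P} Γ → Q ∈ Γ ₋ P → (Q ∈ Γ) × (Q ≢ P)
∈-₋⁻ {Q} {P} (R ∷ Γ) q with R ≟P P
∈-₋⁻ (R ∷ Γ) q | yes _ with ∈-₋⁻ Γ q
... | q' , Q≢P = there q' , Q≢P
∈-₋⁻ (R ∷ Γ) (here refl) | no R≢P = here refl , R≢P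
∈-₋⁻ (R ∷ Γ) (there q) | no _ with ∈-₋⁻ Γ q
... | q' , Q≢P = there q' , Q≢P

⊆∷₋ : ∀ {P} Γ → Γ ⊆ P ∷ (Γ ₋ P)
⊆∷₋ {P} Γ {Q} q with Q ≟P P
... | yes refl = here refl
... | no Q≢P = there (∈-₋⁺ Γ q Q≢P)

₋⊆ : ∀ {P Y} Γ → (∀ {Q} → Q ∈ Γ → Q ≢ P → Q ∈ Y) → Γ ₋ P ⊆ Y
₋⊆ Γ f q with ∈-₋⁻ Γ q
... | q' , Q≢P = f q' Q≢P

drop : Maybe PFormula → List PFormula → List PFormula
drop nothing Γ = Γ
drop (just P) Γ = Γ ₋ P

Kept : Maybe PFormula → PFormula → Set
Kept nothing Q = ⊤
Kept (just P) Q = Q ≢ P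

drop-∈⁺ : ∀ p {Q} Γ → Q ∈ Γ → Kept p Q → Q ∈ drop p Γ
drop-∈⁺ nothing Γ q _ = q
drop-∈⁺ (just P) Γ q Q≢P = ∈-₋⁺ Γ q Q≢P

drop-∈⁻ : ∀ p {Q} Γ → Q ∈ drop p Γ → (Q ∈ Γ) × Kept p Q
drop-∈⁻ nothing Γ q = q , tt
drop-∈⁻ (just P) Γ q = ∈-₋⁻ Γ q

data Deletion : Set where
  keepAll : Deletion
  onLeft onRight : PFormula → Deletion

leftDrop : Deletion → Maybe PFormula
leftDrop (onLeft P) = just P
leftDrop _ = nothing

rightDrop : Deletion → Maybe PFormula
rightDrop (onRight P) = just P
rightDrop _ = nothing

module Transfer {S : System} (m : Maybe (PosMap S)) (p : Maybe PFormula) (E : List PFormula) where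

  out : List PFormula → List PFormula
  out Γ = onCtx m (drop p Γ) ++ E

  out-∈ : ∀ {Q} Γ → Q ∈ Γ → Kept p Q → onP m Q ∈ out Γ
  out-∈ Γ q k = ∈-++⁺ˡ (onCtx-∈ m (drop-∈⁺ p Γ q k))

  out-⊆ : ∀ Γ₁ Γ₂ → Γ₁ ⊆ Γ₂ → out Γ₁ ⊆ out Γ₂
  out-⊆ Γ₁ Γ₂ s r with ∈-++⁻ (onCtx m (drop p Γ₁)) r
  ... | inj₂ e = ∈-++⁺ʳ (onCtx m (drop p Γ₂)) e
  ... | inj₁ a with onCtx-∈⁻ m (drop p Γ₁) a
  ...   | Q , q , refl with drop-∈⁻ p Γ₁ q
  ...     | q' , k = out-∈ Γ₂ (s q') k

  -- The active formula Q of a rule is kept, though it may equal p.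
  out-⊆∷ : ∀ {Q} Γ₁ Γ₂ → Γ₁ ⊆ Q ∷ Γ₂ → out Γ₁ ⊆ onP m Q ∷ out Γ₂
  out-⊆∷ Γ₁ Γ₂ s r with ∈-++⁻ (onCtx m (drop p Γ₁)) r
  ... | inj₂ e = there (∈-++⁺ʳ (onCtx m (drop p Γ₂)) e)
  ... | inj₁ a with onCtx-∈⁻ m (drop p Γ₁) a
  ...   | Q , q , refl with drop-∈⁻ p Γ₁ q
  ...     | q' , k with s q'
  ...       | here refl = here refl
  ...       | there q'' = there (out-∈ Γ₂ q'' k)

  out-fresh : ∀ {y} Γ → (∀ {Q} → Q ∈ Γ → y ∉ pos Q) → (∀ {Q} → Q ∈ E → y ∉ pos Q) → y ∉ reserved m →
              ∀ {R} → R ∈ out Γ → y ∉ pos R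
  out-fresh Γ frΓ frE frT r t with ∈-++⁻ (onCtx m (drop p Γ)) r
  ... | inj₂ e = frE e t
  ... | inj₁ a with onCtx-∈⁻ m (drop p Γ) a
  ...   | Q , q , refl with onPos-tokens m (pos Q) t
  ...     | inj₁ t' = frΓ (proj₁ (drop-∈⁻ p Γ q)) t'
  ...     | inj₂ t' = frT t'

princL : ∀ {S Γ Δ} → Proof S Γ Δ → Maybe PFormula
princL (ax Q) = just Q
princL (¬L A α _) = just ((¬ᶠ A) ^ α)
princL (∧L₁ A B α _) = just ((A ∧ᶠ B) ^ α)
princL (∧L₂ A B α _) = just ((A ∧ᶠ B) ^ α)
princL (∨L A B α _ _) = just ((A ∨ᶠ B) ^ α)
princL (⇒L A B α _ _) = just ((A ⇒ᶠ B) ^ α)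
princL (□L A α _ _ _) = just ((□ A) ^ α)
princL (◇L A α _ _ _) = just ((◇ A) ^ α)
princL _ = nothing

princR : ∀ {S Γ Δ} → Proof S Γ Δ → Maybe PFormula
princR (ax Q) = just Q
princR (¬R A α _) = just ((¬ᶠ A) ^ α)
princR (∧R A B α _ _) = just ((A ∧ᶠ B) ^ α)
princR (∨R₁ A B α _) = just ((A ∨ᶠ B) ^ α)
princR (∨R₂ A B α _) = just ((A ∨ᶠ B) ^ α)
princR (⇒R A B α _) = just ((A ⇒ᶠ B) ^ α)
princR (□R A α _ _ _) = just ((□ A) ^ α)
princR (◇R A α _ _ _) = just ((◇ A) ^ α)
princR _ = nothing

Principal : ∀ {S Γ Δ} → Deletion → Proof S Γ Δ → Set
Principal keepAll π = ⊥
Principal (onLeft P) π = princL π ≡ just P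
Principal (onRight P) π = princR π ≡ just P

principal? : ∀ {S Γ Δ} D (π : Proof S Γ Δ) → Dec (Principal D π)
principal? keepAll π = no λ ()
principal? (onLeft P) π = ≡-dec _≟P_ (princL π) (just P)
principal? (onRight P) π = ≡-dec _≟P_ (princR π) (just P)

keptL : ∀ {S Γ Δ} D (π : Proof S Γ Δ) {Q} → princL π ≡ just Q → ¬ Principal D π → Kept (leftDrop D) Q
keptL keepAll π e np = tt
keptL (onLeft P) π e np Q≡P = np (≡-trans e (cong just Q≡P))
keptL (onRight P) π e np = tt

keptR : ∀ {S Γ Δ} D (π : Proof S Γ Δ) {Q} → princR π ≡ just Q → ¬ Principal D π → Kept (rightDrop D) Q
keptR keepAll π e np = tt
keptR (onLeft P) π e np = tt
keptR (onRight P) π e np Q≡P = np (≡-trans e (cong just Q≡P))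

data IntroR {S : System} : ∀ {Γ Δ} → Proof S Γ Δ → PFormula → Set where
  axR : ∀ Q → IntroR (ax Q) Q
  ¬R-intro : ∀ {Γ Δ} A α (π : Proof S (Γ ++ [ A ^ α ]) Δ) → IntroR (¬R A α π) ((¬ᶠ A) ^ α)
  ∧R-intro : ∀ {Γ₁ Δ₁ Γ₂ Δ₂} A B α (π₁ : Proof S Γ₁ ((A ^ α) ∷ Δ₁)) (π₂ : Proof S Γ₂ ((B ^ α) ∷ Δ₂)) →
             IntroR (∧R A B α π₁ π₂) ((A ∧ᶠ B) ^ α)
  ∨R₁-intro : ∀ {Γ Δ} A B α (π : Proof S Γ ((A ^ α) ∷ Δ)) → IntroR (∨R₁ A B α π) ((A ∨ᶠ B) ^ α)
  ∨R₂-intro : ∀ {Γ Δ} A B α (π : Proof S Γ ((B ^ α) ∷ Δ)) → IntroR (∨R₂ A B α π) ((A ∨ᶠ B) ^ α)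
  ⇒R-intro : ∀ {Γ Δ} A B α (π : Proof S (Γ ++ [ A ^ α ]) ((B ^ α) ∷ Δ)) → IntroR (⇒R A B α π) ((A ⇒ᶠ B) ^ α)
  □R-intro : ∀ {Γ Δ} A α x c (π : Proof S Γ ((A ^ (α ∘ₜ x)) ∷ Δ)) →
             IntroR (□R {Γ = Γ} {Δ = Δ} A α x c π) ((□ A) ^ α)
  ◇R-intro : ∀ {Γ Δ} A α β al (π : Proof S Γ ((A ^ (α ++ β)) ∷ Δ)) → IntroR (◇R A α β al π) ((◇ A) ^ α)

introR : ∀ {S Γ Δ Q} (π : Proof S Γ Δ) → princR π ≡ just Q → IntroR π Q
introR (ax Q) refl = axR Q
introR (¬R A α π) refl = ¬R-intro A α π
introR (∧R A B α π₁ π₂) refl = ∧R-intro A B α π₁ π₂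
introR (∨R₁ A B α π) refl = ∨R₁-intro A B α π
introR (∨R₂ A B α π) refl = ∨R₂-intro A B α π
introR (⇒R A B α π) refl = ⇒R-intro A B α π
introR (□R A α x c π) refl = □R-intro A α x c π
introR (◇R A α β al π) refl = ◇R-intro A α β al π
introR (cut _ _ _) ()
introR (wL _ _) ()
introR (wR _ _) ()
introR (cL _ _) ()
introR (cR _ _) ()
introR (eL _ _ _) ()
introR (eR _ _ _) ()
introR (¬L _ _ _) ()
introR (∧L₁ _ _ _ _) ()
introR (∧L₂ _ _ _ _) ()
introR (∨L _ _ _ _ _) ()
introR (⇒L _ _ _ _ _) ()
introR (□L _ _ _ _ _) ()
introR (◇L _ _ _ _ _) ()

data IntroL {S : System} : ∀ {Γ Δ} → Proof S Γ Δ → PFormula → Set where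
  axL : ∀ Q → IntroL (ax Q) Q
  ¬L-intro : ∀ {Γ Δ} A α (π : Proof S Γ ((A ^ α) ∷ Δ)) → IntroL (¬L A α π) ((¬ᶠ A) ^ α)
  ∧L₁-intro : ∀ {Γ Δ} A B α (π : Proof S (Γ ++ [ A ^ α ]) Δ) → IntroL (∧L₁ A B α π) ((A ∧ᶠ B) ^ α)
  ∧L₂-intro : ∀ {Γ Δ} A B α (π : Proof S (Γ ++ [ B ^ α ]) Δ) → IntroL (∧L₂ A B α π) ((A ∧ᶠ B) ^ α)
  ∨L-intro : ∀ {Γ₁ Δ₁ Γ₂ Δ₂} A B α (π₁ : Proof S (Γ₁ ++ [ A ^ α ]) Δ₁) (π₂ : Proof S (Γ₂ ++ [ B ^ α ]) Δ₂) →
             IntroL (∨L A B α π₁ π₂) ((A ∨ᶠ B) ^ α)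
  ⇒L-intro : ∀ {Γ₁ Δ₁ Γ₂ Δ₂} A B α (π₁ : Proof S Γ₁ ((A ^ α) ∷ Δ₁)) (π₂ : Proof S (Γ₂ ++ [ B ^ α ]) Δ₂) →
             IntroL (⇒L A B α π₁ π₂) ((A ⇒ᶠ B) ^ α)
  □L-intro : ∀ {Γ Δ} A α β al (π : Proof S (Γ ++ [ A ^ (α ++ β) ]) Δ) → IntroL (□L A α β al π) ((□ A) ^ α)
  ◇L-intro : ∀ {Γ Δ} A α x c (π : Proof S (Γ ++ [ A ^ (α ∘ₜ x) ]) Δ) →
             IntroL (◇L {Γ = Γ} {Δ = Δ} A α x c π) ((◇ A) ^ α)

introL : ∀ {S Γ Δ Q} (π : Proof S Γ Δ) → princL π ≡ just Q → IntroL π Q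
introL (ax Q) refl = axL Q
introL (¬L A α π) refl = ¬L-intro A α π
introL (∧L₁ A B α π) refl = ∧L₁-intro A B α π
introL (∧L₂ A B α π) refl = ∧L₂-intro A B α π
introL (∨L A B α π₁ π₂) refl = ∨L-intro A B α π₁ π₂
introL (⇒L A B α π₁ π₂) refl = ⇒L-intro A B α π₁ π₂
introL (□L A α β al π) refl = □L-intro A α β al π
introL (◇L A α x c π) refl = ◇L-intro A α x c π
introL (cut _ _ _) ()
introL (wL _ _) ()
introL (wR _ _) ()
introL (cL _ _) ()
introL (cR _ _) ()
introL (eL _ _ _) ()
introL (eR _ _ _) ()
introL (¬R _ _ _) ()
introL (∧R _ _ _ _ _) ()
introL (∨R₁ _ _ _ _) ()
introL (∨R₂ _ _ _ _) ()
introL (⇒R _ _ _ _) ()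
introL (□R _ _ _ _ _) ()
introL (◇R _ _ _ _ _) ()

<-premise₁ : ∀ {a b k} → suc (a ⊔ b) ≤ k → a < k
<-premise₁ {a} {b} h = ≤-trans (s≤s (m≤m⊔n a b)) h

<-premise₂ : ∀ {a b k} → suc (a ⊔ b) ≤ k → b < k
<-premise₂ {a} {b} h = ≤-trans (s≤s (m≤n⊔m a b)) h

⊔-boundˡ : ∀ {a b c} → a ⊔ b ≤ c → a ≤ c
⊔-boundˡ {a} {b} = m⊔n≤o⇒m≤o a b

⊔-boundʳ : ∀ {a b c} → a ⊔ b ≤ c → b ≤ c
⊔-boundʳ {a} {b} = m⊔n≤o⇒n≤o a b

module _ {A : Set} where
  snoc⊆∷snoc : ∀ {a b : A} Γ → Γ ++ [ a ] ⊆ a ∷ (Γ ++ [ b ])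
  snoc⊆∷snoc Γ = ++⊆ (λ q → there (∈-++⁺ˡ q)) (∈-∷⁺ʳ (here refl) []⊆)

  swap⊆ : ∀ {a b : A} Γ₁ Γ₂ → Γ₁ ++ a ∷ b ∷ Γ₂ ⊆ Γ₁ ++ b ∷ a ∷ Γ₂
  swap⊆ Γ₁ Γ₂ = ++⊆ ∈-++⁺ˡ (∈-∷⁺ʳ (∈-++⁺ʳ Γ₁ (there (here refl)))
                  (∈-∷⁺ʳ (∈-++⁺ʳ Γ₁ (here refl)) (λ q → ∈-++⁺ʳ Γ₁ (there (there q)))))

module Traversal (S : System) (n : ℕ) (D : Deletion) (m : Maybe (PosMap S)) (Eₗ Eᵣ : List PFormula) where
  open Rules⊆ {S} {n}
  open Transfer m (leftDrop D) Eₗ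
    renaming (out to outL; out-∈ to outL-∈; out-⊆ to outL-⊆; out-⊆∷ to outL-⊆∷; out-fresh to outL-fresh)
    public
  open Transfer m (rightDrop D) Eᵣ
    renaming (out to outR; out-∈ to outR-∈; out-⊆ to outR-⊆; out-⊆∷ to outR-⊆∷; out-fresh to outR-fresh)
    public

  Target : List PFormula → List PFormula → Set
  Target Γ Δ = Prv S (outL Γ) (outR Δ) n

  Below : ℕ → Set
  Below k = ∀ {Γ Δ} (π : Proof S Γ Δ) → ht π < k → g π ≤ n → Target Γ Δ

  Handler : Set
  Handler = ∀ k {Γ Δ} (π : Proof S Γ Δ) → Principal D π → ht π ≤ k → g π ≤ n → Below k → Target Γ Δ

  σ : Position → Position
  σ = onPos m

  eigen-out : ∀ {y δ} Γ Δ → (∀ {R} → R ∈ Γ ++ Δ ++ Eₗ ++ Eᵣ → y ∉ pos R) → y ∉ reserved m →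
              ¬ ((δ ∘ₜ y) ∈I (outL Γ ++ outR Δ))
  eigen-out Γ Δ frW frT = fresh∉I (outL Γ ++ outR Δ) fr
    where
    fr : ∀ {R} → R ∈ outL Γ ++ outR Δ → _ ∉ pos R
    fr q with ∈-++⁻ (outL Γ) q
    ... | inj₁ a = outL-fresh Γ (λ q → frW (∈-++⁺ˡ q)) (λ q → frW (∈-++⁺ʳ Γ (∈-++⁺ʳ Δ (∈-++⁺ˡ q)))) frT a
    ... | inj₂ b = outR-fresh Δ (λ q → frW (∈-++⁺ʳ Γ (∈-++⁺ˡ q))) (λ q → frW (∈-++⁺ʳ Γ (∈-++⁺ʳ Δ (∈-++⁺ʳ Eₗ q)))) frT b

  -- □R not introducing the deleted formula: move the premise to a token y
  -- fresh for everything in sight, transform it, and reapply □R at σ α ∘ y.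
  copy□R : ∀ k {Γ₀ Δ₀} A α x → ¬ ((α ∘ₜ x) ∈I (Γ₀ ++ Δ₀)) → (π₀ : Proof S Γ₀ ((A ^ (α ∘ₜ x)) ∷ Δ₀)) →
           Kept (rightDrop D) ((□ A) ^ α) → ht π₀ < k → g π₀ ≤ n → Below k → Target Γ₀ (((□ A) ^ α) ∷ Δ₀)
  copy□R k {Γ₀} {Δ₀} A α x c π₀ kept h gh rec with freshFor (Γ₀ ++ ((□ A) ^ α ∷ Δ₀) ++ Eₗ ++ Eᵣ) (reserved m)
  ... | y , frW , frT with renameEigenR α x y c (fresh∉I (Γ₀ ++ Δ₀) (λ q → frW (sub q))) π₀
    where
    sub : Γ₀ ++ Δ₀ ⊆ Γ₀ ++ ((□ A) ^ α ∷ Δ₀) ++ Eₗ ++ Eᵣ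
    sub = ++⊆ {X = Γ₀} ∈-++⁺ˡ (λ q → ∈-++⁺ʳ Γ₀ (there (∈-++⁺ˡ q)))
  ... | π₀' , eg , eh =
    □R⊆ A (σ α) y (eigen-out Γ₀ (_ ∷ Δ₀) frW frT)
      (rec π₀' (subst (_< k) (sym eh) h) (subst (_≤ n) (sym eg) gh)) ⊆-refl
      (subst (λ u → outR ((A ^ (α ∘ₜ y)) ∷ Δ₀) ⊆ (A ^ u) ∷ outR (_ ∷ Δ₀)) (onPos-∘ₜ m α y frT)
        (outR-⊆∷ ((A ^ (α ∘ₜ y)) ∷ Δ₀) (_ ∷ Δ₀) (∈-∷⁺ʳ (here refl) (λ q → there (there q)))))
      (outR-∈ (_ ∷ Δ₀) (here refl) kept)

  copy◇L : ∀ k {Γ₀ Δ₀} A α x → ¬ ((α ∘ₜ x) ∈I (Γ₀ ++ Δ₀)) → (π₀ : Proof S (Γ₀ ++ [ A ^ (α ∘ₜ x) ]) Δ₀) →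
           Kept (leftDrop D) ((◇ A) ^ α) → ht π₀ < k → g π₀ ≤ n → Below k → Target (Γ₀ ++ [ (◇ A) ^ α ]) Δ₀
  copy◇L k {Γ₀} {Δ₀} A α x c π₀ kept h gh rec with freshFor ((Γ₀ ++ [ (◇ A) ^ α ]) ++ Δ₀ ++ Eₗ ++ Eᵣ) (reserved m)
  ... | y , frW , frT with renameEigenL α x y c (fresh∉I (Γ₀ ++ Δ₀) (λ q → frW (sub q))) π₀
    where
    sub : Γ₀ ++ Δ₀ ⊆ (Γ₀ ++ [ (◇ A) ^ α ]) ++ Δ₀ ++ Eₗ ++ Eᵣ
    sub = ++⊆ {X = Γ₀} (λ q → ∈-++⁺ˡ (∈-++⁺ˡ q)) (λ q → ∈-++⁺ʳ (Γ₀ ++ [ _ ]) (∈-++⁺ˡ q))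
  ... | π₀' , eg , eh =
    ◇L⊆ A (σ α) y (eigen-out (Γ₀ ++ [ _ ]) Δ₀ frW frT)
      (rec π₀' (subst (_< k) (sym eh) h) (subst (_≤ n) (sym eg) gh))
      (subst (λ u → outL (Γ₀ ++ [ A ^ (α ∘ₜ y) ]) ⊆ (A ^ u) ∷ outL (Γ₀ ++ [ _ ])) (onPos-∘ₜ m α y frT)
        (outL-⊆∷ (Γ₀ ++ [ A ^ (α ∘ₜ y) ]) (Γ₀ ++ [ _ ]) (snoc⊆∷snoc Γ₀)))
      ⊆-refl (outL-∈ (Γ₀ ++ [ _ ]) (∈-snoc Γ₀) kept)

  copyRule : ∀ k {Γ Δ} (π : Proof S Γ Δ) → ¬ Principal D π → ht π ≤ k → g π ≤ n → Below k → Target Γ Δ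
  copyRule k π@(ax Q) np h gh rec =
    ax⊆ (onP m Q) (outL-∈ [ Q ] (here refl) (keptL D π refl np)) (outR-∈ [ Q ] (here refl) (keptR D π refl np))
  copyRule k (cut {Γ₁} {Δ₁} {Γ₂} {Δ₂} Q π₁ π₂) np h gh rec =
    cut⊆ (onP m Q) (⊔-boundˡ {suc (pdeg Q)} {g π₁ ⊔ g π₂} gh)
      (rec π₁ (<-premise₁ h) (⊔-boundˡ {g π₁} (⊔-boundʳ {suc (pdeg Q)} gh)))
      (rec π₂ (<-premise₂ h) (⊔-boundʳ {g π₁} (⊔-boundʳ {suc (pdeg Q)} gh)))
      (outL-⊆ Γ₁ (Γ₁ ++ Γ₂) ∈-++⁺ˡ)
      (outL-⊆∷ (Γ₂ ++ [ Q ]) (Γ₁ ++ Γ₂) (++⊆ (λ q → there (∈-++⁺ʳ Γ₁ q)) (∈-∷⁺ʳ (here refl) []⊆)))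
      (outR-⊆∷ (Q ∷ Δ₁) (Δ₁ ++ Δ₂) (∈-∷⁺ʳ (here refl) (λ q → there (∈-++⁺ˡ q))))
      (outR-⊆ Δ₂ (Δ₁ ++ Δ₂) (∈-++⁺ʳ Δ₁))
  copyRule k (wL {Γ₀} Q π₀) np h gh rec = struct (outL-⊆ Γ₀ (Γ₀ ++ [ Q ]) ∈-++⁺ˡ) ⊆-refl (rec π₀ h gh)
  copyRule k (wR {Γ₀} {Δ₀} Q π₀) np h gh rec = struct ⊆-refl (outR-⊆ Δ₀ (Q ∷ Δ₀) there) (rec π₀ h gh)
  copyRule k (cL {Γ₀} Q π₀) np h gh rec =
    struct (outL-⊆ (Γ₀ ++ Q ∷ Q ∷ []) (Γ₀ ++ [ Q ]) (++⊆ ∈-++⁺ˡ (∈-∷⁺ʳ (∈-snoc Γ₀) (∈-∷⁺ʳ (∈-snoc Γ₀) []⊆))))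
      ⊆-refl (rec π₀ h gh)
  copyRule k (cR {Γ₀} {Δ₀} Q π₀) np h gh rec =
    struct ⊆-refl (outR-⊆ (Q ∷ Q ∷ Δ₀) (Q ∷ Δ₀) (∈-∷⁺ʳ (here refl) ⊆-refl)) (rec π₀ h gh)
  copyRule k (eL {Γ₁} {Γ₂} Q R π₀) np h gh rec = struct (outL-⊆ _ _ (swap⊆ Γ₁ Γ₂)) ⊆-refl (rec π₀ h gh)
  copyRule k (eR {Γ₀} {Δ₁} {Δ₂} Q R π₀) np h gh rec = struct ⊆-refl (outR-⊆ _ _ (swap⊆ Δ₁ Δ₂)) (rec π₀ h gh)
  copyRule k π@(¬L {Γ₀} {Δ₀} A α π₀) np h gh rec =
    ¬L⊆ A (σ α) (rec π₀ h gh) (outL-⊆ Γ₀ (Γ₀ ++ [ _ ]) ∈-++⁺ˡ) (outR-⊆∷ ((A ^ α) ∷ Δ₀) Δ₀ ⊆-refl)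
      (outL-∈ (Γ₀ ++ [ _ ]) (∈-snoc Γ₀) (keptL D π refl np))
  copyRule k π@(¬R {Γ₀} {Δ₀} A α π₀) np h gh rec =
    ¬R⊆ A (σ α) (rec π₀ h gh) (outL-⊆∷ (Γ₀ ++ [ A ^ α ]) Γ₀ (++⊆ there (∈-∷⁺ʳ (here refl) []⊆)))
      (outR-⊆ Δ₀ (_ ∷ Δ₀) there) (outR-∈ (_ ∷ Δ₀) (here refl) (keptR D π refl np))
  copyRule k π@(∧L₁ {Γ₀} {Δ₀} A B α π₀) np h gh rec =
    ∧L₁⊆ A B (σ α) (rec π₀ h gh) (outL-⊆∷ (Γ₀ ++ [ A ^ α ]) (Γ₀ ++ [ _ ]) (snoc⊆∷snoc Γ₀)) ⊆-refl
      (outL-∈ (Γ₀ ++ [ _ ]) (∈-snoc Γ₀) (keptL D π refl np))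
  copyRule k π@(∧L₂ {Γ₀} {Δ₀} A B α π₀) np h gh rec =
    ∧L₂⊆ A B (σ α) (rec π₀ h gh) (outL-⊆∷ (Γ₀ ++ [ B ^ α ]) (Γ₀ ++ [ _ ]) (snoc⊆∷snoc Γ₀)) ⊆-refl
      (outL-∈ (Γ₀ ++ [ _ ]) (∈-snoc Γ₀) (keptL D π refl np))
  copyRule k π@(∧R {Γ₁} {Δ₁} {Γ₂} {Δ₂} A B α π₁ π₂) np h gh rec =
    ∧R⊆ A B (σ α) (rec π₁ (<-premise₁ h) (⊔-boundˡ gh)) (rec π₂ (<-premise₂ h) (⊔-boundʳ gh))
      (outL-⊆ Γ₁ (Γ₁ ++ Γ₂) ∈-++⁺ˡ) (outL-⊆ Γ₂ (Γ₁ ++ Γ₂) (∈-++⁺ʳ Γ₁))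
      (outR-⊆∷ ((A ^ α) ∷ Δ₁) (_ ∷ Δ₁ ++ Δ₂) (∈-∷⁺ʳ (here refl) (λ q → there (there (∈-++⁺ˡ q)))))
      (outR-⊆∷ ((B ^ α) ∷ Δ₂) (_ ∷ Δ₁ ++ Δ₂) (∈-∷⁺ʳ (here refl) (λ q → there (there (∈-++⁺ʳ Δ₁ q)))))
      (outR-∈ (_ ∷ Δ₁ ++ Δ₂) (here refl) (keptR D π refl np))
  copyRule k π@(∨L {Γ₁} {Δ₁} {Γ₂} {Δ₂} A B α π₁ π₂) np h gh rec =
    ∨L⊆ A B (σ α) (rec π₁ (<-premise₁ h) (⊔-boundˡ gh)) (rec π₂ (<-premise₂ h) (⊔-boundʳ gh))
      (outL-⊆∷ (Γ₁ ++ [ A ^ α ]) (Γ₁ ++ Γ₂ ++ [ _ ]) (++⊆ (λ q → there (∈-++⁺ˡ q)) (∈-∷⁺ʳ (here refl) []⊆)))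
      (outL-⊆∷ (Γ₂ ++ [ B ^ α ]) (Γ₁ ++ Γ₂ ++ [ _ ]) (++⊆ (λ q → there (∈-++⁺ʳ Γ₁ (∈-++⁺ˡ q))) (∈-∷⁺ʳ (here refl) []⊆)))
      (outR-⊆ Δ₁ (Δ₁ ++ Δ₂) ∈-++⁺ˡ) (outR-⊆ Δ₂ (Δ₁ ++ Δ₂) (∈-++⁺ʳ Δ₁))
      (outL-∈ (Γ₁ ++ Γ₂ ++ [ _ ]) (∈-++⁺ʳ Γ₁ (∈-snoc Γ₂)) (keptL D π refl np))
  copyRule k π@(∨R₁ {Γ₀} {Δ₀} A B α π₀) np h gh rec =
    ∨R₁⊆ A B (σ α) (rec π₀ h gh) ⊆-refl
      (outR-⊆∷ ((A ^ α) ∷ Δ₀) (_ ∷ Δ₀) (∈-∷⁺ʳ (here refl) (λ q → there (there q))))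
      (outR-∈ (_ ∷ Δ₀) (here refl) (keptR D π refl np))
  copyRule k π@(∨R₂ {Γ₀} {Δ₀} A B α π₀) np h gh rec =
    ∨R₂⊆ A B (σ α) (rec π₀ h gh) ⊆-refl
      (outR-⊆∷ ((B ^ α) ∷ Δ₀) (_ ∷ Δ₀) (∈-∷⁺ʳ (here refl) (λ q → there (there q))))
      (outR-∈ (_ ∷ Δ₀) (here refl) (keptR D π refl np))
  copyRule k π@(⇒L {Γ₁} {Δ₁} {Γ₂} {Δ₂} A B α π₁ π₂) np h gh rec =
    ⇒L⊆ A B (σ α) (rec π₁ (<-premise₁ h) (⊔-boundˡ gh)) (rec π₂ (<-premise₂ h) (⊔-boundʳ gh))
      (outL-⊆ Γ₁ (Γ₁ ++ Γ₂ ++ [ _ ]) ∈-++⁺ˡ)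
      (outR-⊆∷ ((A ^ α) ∷ Δ₁) (Δ₁ ++ Δ₂) (∈-∷⁺ʳ (here refl) (λ q → there (∈-++⁺ˡ q))))
      (outL-⊆∷ (Γ₂ ++ [ B ^ α ]) (Γ₁ ++ Γ₂ ++ [ _ ]) (++⊆ (λ q → there (∈-++⁺ʳ Γ₁ (∈-++⁺ˡ q))) (∈-∷⁺ʳ (here refl) []⊆)))
      (outR-⊆ Δ₂ (Δ₁ ++ Δ₂) (∈-++⁺ʳ Δ₁))
      (outL-∈ (Γ₁ ++ Γ₂ ++ [ _ ]) (∈-++⁺ʳ Γ₁ (∈-snoc Γ₂)) (keptL D π refl np))
  copyRule k π@(⇒R {Γ₀} {Δ₀} A B α π₀) np h gh rec =
    ⇒R⊆ A B (σ α) (rec π₀ h gh) (outL-⊆∷ (Γ₀ ++ [ A ^ α ]) Γ₀ (++⊆ there (∈-∷⁺ʳ (here refl) []⊆)))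
      (outR-⊆∷ ((B ^ α) ∷ Δ₀) (_ ∷ Δ₀) (∈-∷⁺ʳ (here refl) (λ q → there (there q))))
      (outR-∈ (_ ∷ Δ₀) (here refl) (keptR D π refl np))
  copyRule k π@(□L {Γ₀} {Δ₀} A α β al π₀) np h gh rec with onPos-allowed m α β al
  ... | β' , e , al' =
    □L⊆ A (σ α) β' al' (rec π₀ h gh)
      (subst (λ u → outL (Γ₀ ++ [ A ^ (α ++ β) ]) ⊆ (A ^ u) ∷ outL (Γ₀ ++ [ _ ])) e
        (outL-⊆∷ (Γ₀ ++ [ A ^ (α ++ β) ]) (Γ₀ ++ [ _ ]) (snoc⊆∷snoc Γ₀)))
      ⊆-refl (outL-∈ (Γ₀ ++ [ _ ]) (∈-snoc Γ₀) (keptL D π refl np))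
  copyRule k π@(◇R {Γ₀} {Δ₀} A α β al π₀) np h gh rec with onPos-allowed m α β al
  ... | β' , e , al' =
    ◇R⊆ A (σ α) β' al' (rec π₀ h gh) ⊆-refl
      (subst (λ u → outR ((A ^ (α ++ β)) ∷ Δ₀) ⊆ (A ^ u) ∷ outR (_ ∷ Δ₀)) e
        (outR-⊆∷ ((A ^ (α ++ β)) ∷ Δ₀) (_ ∷ Δ₀) (∈-∷⁺ʳ (here refl) (λ q → there (there q)))))
      (outR-∈ (_ ∷ Δ₀) (here refl) (keptR D π refl np))
  copyRule k π@(□R A α x c π₀) np h gh rec = copy□R k A α x c π₀ (keptR D π refl np) h gh rec
  copyRule k π@(◇L A α x c π₀) np h gh rec = copy◇L k A α x c π₀ (keptL D π refl np) h gh rec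

  module Run (handle : Handler) where
    run : ∀ k {Γ Δ} (π : Proof S Γ Δ) → ht π < k → g π ≤ n → Target Γ Δ
    run (suc k) π (s≤s h) gh with principal? D π
    ... | yes pp = handle k π pp h gh (run k)
    ... | no np = copyRule k π np h gh (run k)

    transform : ∀ {Γ Δ} (π : Proof S Γ Δ) → g π ≤ n → Target Γ Δ
    transform π = run (suc (ht π)) π ≤-refl

++[]⊆ : {Γ : List PFormula} → Γ ++ [] ⊆ Γ
++[]⊆ = ++⊆ ⊆-refl []⊆

-- Substituting α∘x ↦ α++β, for an admitted β, throughout a proof.  Used
-- with a fresh x, it turns a □R/◇L premise at α∘x into the premise of the
-- corresponding □L/◇R step at α++β.
module Instantiate (S : System) (n : ℕ) (α : Position) (x : Token) (β : Position) (al : Allowed S β) where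
  open Traversal S n keepAll (just (replaceMap S α x β al)) [] []

  σᴾ : PFormula → PFormula
  σᴾ = onP (just (replaceMap S α x β al))

  -- Nothing is deleted, so no rule needs a handler.
  substitute : ∀ {Γ Δ} (π : Proof S Γ Δ) → g π ≤ n → Prv S (map σᴾ Γ ++ []) (map σᴾ Δ ++ []) n
  substitute = Run.transform (λ k π ())

  LandsIn : List PFormula → PFormula → Set
  LandsIn Y Q = (x ∉ pos Q × Q ∈ Y) ⊎ Σ Formula (λ A → (Q ≡ A ^ (α ∘ₜ x)) × (A ^ (α ++ β)) ∈ Y)

  σᴾ-lands : ∀ {Y Q} → LandsIn Y Q → σᴾ Q ∈ Y
  σᴾ-lands {Y} {B ^ δ} (inj₁ (x∉ , q)) =
    subst (_∈ Y) (cong (B ^_) (sym (replaceAfter-fix α x β δ (λ p → x∉ (∘ₜ-⪯⇒∈ p))))) q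
  σᴾ-lands {Y} (inj₂ (A , refl , q)) = subst (_∈ Y) (cong (A ^_) (sym (replaceAfter-hit α x β))) q

  instantiate : ∀ {Γ Δ Γ' Δ'} → (∀ {Q} → Q ∈ Γ' → LandsIn Γ Q) → (∀ {Q} → Q ∈ Δ' → LandsIn Δ Q) →
                Prv S Γ' Δ' n → Prv S Γ Δ n
  instantiate fΓ fΔ (π , d) = struct (++⊆ (image fΓ) []⊆) (++⊆ (image fΔ) []⊆) (substitute π d)
    where
    image : ∀ {L Y} → (∀ {Q} → Q ∈ L → LandsIn Y Q) → map σᴾ L ⊆ Y
    image f q with ∈-map⁻ σᴾ q
    ... | Q , q' , refl = σᴾ-lands (f q')

₋++⊆ : ∀ {P} X Y E → (∀ {Q} → Q ∈ X → Q ∈ E ⊎ Q ∈ Y) → (X ₋ P) ++ E ⊆ (Y ₋ P) ++ E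
₋++⊆ X Y E f = ++⊆ (₋⊆ X (λ q Q≢P → into (f q) Q≢P)) (∈-++⁺ʳ _)
  where
  into : ∀ {Q} → Q ∈ E ⊎ Q ∈ Y → Q ≢ _ → Q ∈ (Y ₋ _) ++ E
  into (inj₁ e) Q≢P = ∈-++⁺ʳ _ e
  into (inj₂ y) Q≢P = ∈-++⁺ˡ (∈-₋⁺ Y y Q≢P)

-- An axiom P ⊢ P becomes an instance
-- of the corresponding left rule; an introduction of P is replaced by its
-- premise.  Inversions do not add cuts, so the degree bound is kept.
module Invert¬R (S : System) (n : ℕ) (A : Formula) (α : Position) where
  P : PFormula
  P = (¬ᶠ A) ^ α
  open Traversal S n (onRight P) nothing [ A ^ α ] []

  handle : Handler
  handle k π pp h gd rec with introR π pp
  ... | axR _ = struct (++⊆ there (∈-∷⁺ʳ (here refl) []⊆)) []⊆ (¬L A α (ax (A ^ α)) , z≤n)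
  ... | ¬R-intro {Γ₀} {Δ₀} _ _ π₀ =
    struct (++⊆ ⊆-refl (∈-∷⁺ʳ (∈-snoc Γ₀) []⊆)) (₋++⊆ Δ₀ (P ∷ Δ₀) [] (λ q → inj₂ (there q))) (rec π₀ h gd)

  invert : ∀ {Γ Δ} (π : Proof S Γ Δ) → g π ≤ n → Prv S (Γ ++ [ A ^ α ]) ((Δ ₋ P) ++ []) n
  invert = Run.transform handle

module Invert∧R₁ (S : System) (n : ℕ) (A B : Formula) (α : Position) where
  P : PFormula
  P = (A ∧ᶠ B) ^ α
  open Traversal S n (onRight P) nothing [] [ A ^ α ]

  handle : Handler
  handle k π pp h gd rec with introR π pp
  ... | axR _ = struct (∈-∷⁺ʳ (here refl) []⊆) (∈-∷⁺ʳ (∈-++⁺ʳ _ (here refl)) []⊆) (∧L₁ {Γ = []} A B α (ax (A ^ α)) , z≤n)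
  ... | ∧R-intro {Γ₁} {Δ₁} {Γ₂} {Δ₂} _ _ _ π₁ π₂ =
    struct (++⊆ (λ q → ∈-++⁺ˡ (∈-++⁺ˡ q)) []⊆)
      (₋++⊆ ((A ^ α) ∷ Δ₁) (P ∷ Δ₁ ++ Δ₂) [ A ^ α ]
        (λ { (here refl) → inj₁ (here refl) ; (there q) → inj₂ (there (∈-++⁺ˡ q)) }))
      (rec π₁ (<-premise₁ h) (⊔-boundˡ gd))

  invert : ∀ {Γ Δ} (π : Proof S Γ Δ) → g π ≤ n → Prv S (Γ ++ []) ((Δ ₋ P) ++ [ A ^ α ]) n
  invert = Run.transform handle

module Invert∧R₂ (S : System) (n : ℕ) (A B : Formula) (α : Position) where
  P : PFormula
  P = (A ∧ᶠ B) ^ α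
  open Traversal S n (onRight P) nothing [] [ B ^ α ]

  handle : Handler
  handle k π pp h gd rec with introR π pp
  ... | axR _ = struct (∈-∷⁺ʳ (here refl) []⊆) (∈-∷⁺ʳ (∈-++⁺ʳ _ (here refl)) []⊆) (∧L₂ {Γ = []} A B α (ax (B ^ α)) , z≤n)
  ... | ∧R-intro {Γ₁} {Δ₁} {Γ₂} {Δ₂} _ _ _ π₁ π₂ =
    struct (++⊆ (λ q → ∈-++⁺ˡ (∈-++⁺ʳ Γ₁ q)) []⊆)
      (₋++⊆ ((B ^ α) ∷ Δ₂) (P ∷ Δ₁ ++ Δ₂) [ B ^ α ]
        (λ { (here refl) → inj₁ (here refl) ; (there q) → inj₂ (there (∈-++⁺ʳ Δ₁ q)) }))
      (rec π₂ (<-premise₂ h) (⊔-boundʳ gd))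

  invert : ∀ {Γ Δ} (π : Proof S Γ Δ) → g π ≤ n → Prv S (Γ ++ []) ((Δ ₋ P) ++ [ B ^ α ]) n
  invert = Run.transform handle

module Invert∨R (S : System) (n : ℕ) (A B : Formula) (α : Position) where
  P : PFormula
  P = (A ∨ᶠ B) ^ α
  open Traversal S n (onRight P) nothing [] ((A ^ α) ∷ (B ^ α) ∷ [])

  handle : Handler
  handle k π pp h gd rec with introR π pp
  ... | axR _ =
    struct (∈-∷⁺ʳ (here refl) []⊆) (∈-∷⁺ʳ (∈-++⁺ʳ _ (here refl)) (∈-∷⁺ʳ (∈-++⁺ʳ _ (there (here refl))) []⊆))
      (∨L {Γ₁ = []} {Γ₂ = []} A B α (ax (A ^ α)) (ax (B ^ α)) , z≤n)
  ... | ∨R₁-intro {Γ₀} {Δ₀} _ _ _ π₀ =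
    struct ⊆-refl (₋++⊆ ((A ^ α) ∷ Δ₀) (P ∷ Δ₀) _
      (λ { (here refl) → inj₁ (here refl) ; (there q) → inj₂ (there q) })) (rec π₀ h gd)
  ... | ∨R₂-intro {Γ₀} {Δ₀} _ _ _ π₀ =
    struct ⊆-refl (₋++⊆ ((B ^ α) ∷ Δ₀) (P ∷ Δ₀) _
      (λ { (here refl) → inj₁ (there (here refl)) ; (there q) → inj₂ (there q) })) (rec π₀ h gd)

  invert : ∀ {Γ Δ} (π : Proof S Γ Δ) → g π ≤ n → Prv S (Γ ++ []) ((Δ ₋ P) ++ (A ^ α) ∷ (B ^ α) ∷ []) n
  invert = Run.transform handle

module Invert⇒R (S : System) (n : ℕ) (A B : Formula) (α : Position) where
  P : PFormula
  P = (A ⇒ᶠ B) ^ α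
  open Traversal S n (onRight P) nothing [ A ^ α ] [ B ^ α ]

  handle : Handler
  handle k π pp h gd rec with introR π pp
  ... | axR _ = struct (∈-∷⁺ʳ (there (here refl)) (∈-∷⁺ʳ (here refl) []⊆)) (∈-∷⁺ʳ (∈-++⁺ʳ _ (here refl)) []⊆)
                  (⇒L {Γ₁ = [ A ^ α ]} {Δ₁ = []} {Γ₂ = []} {Δ₂ = [ B ^ α ]} A B α (ax (A ^ α)) (ax (B ^ α)) , z≤n)
  ... | ⇒R-intro {Γ₀} {Δ₀} _ _ _ π₀ =
    struct (++⊆ ⊆-refl (∈-∷⁺ʳ (∈-snoc Γ₀) []⊆))
      (₋++⊆ ((B ^ α) ∷ Δ₀) (P ∷ Δ₀) _ (λ { (here refl) → inj₁ (here refl) ; (there q) → inj₂ (there q) }))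
      (rec π₀ h gd)

  invert : ∀ {Γ Δ} (π : Proof S Γ Δ) → g π ≤ n → Prv S (Γ ++ [ A ^ α ]) ((Δ ₋ P) ++ [ B ^ α ]) n
  invert = Run.transform handle

-- □R is inverted at any admitted extension α++β: the premise at the
-- eigen-token x is renamed to a token x' fresh for the sequent and for α, β,
-- inverted, and x' is instantiated by β.
module Invert□R (S : System) (n : ℕ) (A : Formula) (α β : Position) (al : Allowed S β) where
  P : PFormula
  P = (□ A) ^ α
  A' : PFormula
  A' = A ^ (α ++ β)
  open Traversal S n (onRight P) nothing [] [ A' ]

  premise : ∀ k {Γ₀ Δ₀} x → ¬ ((α ∘ₜ x) ∈I (Γ₀ ++ Δ₀)) → (π₀ : Proof S Γ₀ ((A ^ (α ∘ₜ x)) ∷ Δ₀)) →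
            ht π₀ < k → g π₀ ≤ n → Below k → Target Γ₀ (P ∷ Δ₀)
  premise k {Γ₀} {Δ₀} x c π₀ h gd rec with freshFor (Γ₀ ++ Δ₀) (α ++ β)
  ... | x' , frW , frαβ with renameEigenR α x x' c (fresh∉I (Γ₀ ++ Δ₀) frW) π₀
  ... | π₀' , eg , eh =
    instantiate (λ q → inj₁ (frW (∈-++⁺ˡ (++[]⊆ q)) , q)) lands
      (rec π₀' (subst (_< k) (sym eh) h) (subst (_≤ n) (sym eg) gd))
    where
    open Instantiate S n α x' β al
    Y : List PFormula
    Y = ((P ∷ Δ₀) ₋ P) ++ [ A' ]
    lands : ∀ {Q} → Q ∈ (((A ^ (α ∘ₜ x')) ∷ Δ₀) ₋ P) ++ [ A' ] → LandsIn Y Q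
    lands q with ∈-++⁻ (((A ^ (α ∘ₜ x')) ∷ Δ₀) ₋ P) q
    ... | inj₂ (here refl) = inj₁ (frαβ , ∈-++⁺ʳ _ (here refl))
    ... | inj₁ q' with ∈-₋⁻ ((A ^ (α ∘ₜ x')) ∷ Δ₀) q'
    ...   | here refl , _ = inj₂ (A , refl , ∈-++⁺ʳ _ (here refl))
    ...   | there q'' , Q≢P = inj₁ (frW (∈-++⁺ʳ Γ₀ q'') , ∈-++⁺ˡ (∈-₋⁺ (P ∷ Δ₀) (there q'') Q≢P))

  handle : Handler
  handle k π pp h gd rec with introR π pp
  ... | axR _ = struct (∈-∷⁺ʳ (here refl) []⊆) (∈-∷⁺ʳ (∈-++⁺ʳ _ (here refl)) []⊆) (□L {Γ = []} A α β al (ax A') , z≤n)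
  ... | □R-intro _ _ x c π₀ = premise k x c π₀ h gd rec

  invert : ∀ {Γ Δ} (π : Proof S Γ Δ) → g π ≤ n → Prv S (Γ ++ []) ((Δ ₋ P) ++ [ A' ]) n
  invert = Run.transform handle

module Invert◇L (S : System) (n : ℕ) (A : Formula) (α β : Position) (al : Allowed S β) where
  P : PFormula
  P = (◇ A) ^ α
  A' : PFormula
  A' = A ^ (α ++ β)
  open Traversal S n (onLeft P) nothing [ A' ] []

  premise : ∀ k {Γ₀ Δ₀} x → ¬ ((α ∘ₜ x) ∈I (Γ₀ ++ Δ₀)) → (π₀ : Proof S (Γ₀ ++ [ A ^ (α ∘ₜ x) ]) Δ₀) →
            ht π₀ < k → g π₀ ≤ n → Below k → Target (Γ₀ ++ [ P ]) Δ₀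
  premise k {Γ₀} {Δ₀} x c π₀ h gd rec with freshFor (Γ₀ ++ Δ₀) (α ++ β)
  ... | x' , frW , frαβ with renameEigenL α x x' c (fresh∉I (Γ₀ ++ Δ₀) frW) π₀
  ... | π₀' , eg , eh =
    instantiate lands (λ q → inj₁ (frW (∈-++⁺ʳ Γ₀ (++[]⊆ q)) , q))
      (rec π₀' (subst (_< k) (sym eh) h) (subst (_≤ n) (sym eg) gd))
    where
    open Instantiate S n α x' β al
    Y : List PFormula
    Y = ((Γ₀ ++ [ P ]) ₋ P) ++ [ A' ]
    lands : ∀ {Q} → Q ∈ ((Γ₀ ++ [ A ^ (α ∘ₜ x') ]) ₋ P) ++ [ A' ] → LandsIn Y Q
    lands q with ∈-++⁻ ((Γ₀ ++ [ A ^ (α ∘ₜ x') ]) ₋ P) q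
    ... | inj₂ (here refl) = inj₁ (frαβ , ∈-++⁺ʳ _ (here refl))
    ... | inj₁ q' with ∈-₋⁻ (Γ₀ ++ [ A ^ (α ∘ₜ x') ]) q'
    ...   | q'' , Q≢P with ∈-snoc⁻ Γ₀ q''
    ...     | inj₁ q₀ = inj₁ (frW (∈-++⁺ˡ q₀) , ∈-++⁺ˡ (∈-₋⁺ (Γ₀ ++ [ P ]) (∈-++⁺ˡ q₀) Q≢P))
    ...     | inj₂ refl = inj₂ (A , refl , ∈-++⁺ʳ _ (here refl))

  handle : Handler
  handle k π pp h gd rec with introL π pp
  ... | axL _ = struct (∈-∷⁺ʳ (∈-++⁺ʳ _ (here refl)) []⊆) (∈-∷⁺ʳ (here refl) []⊆) (◇R A α β al (ax A') , z≤n)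
  ... | ◇L-intro _ _ x c π₀ = premise k x c π₀ h gd rec

  invert : ∀ {Γ Δ} (π : Proof S Γ Δ) → g π ≤ n → Prv S ((Γ ₋ P) ++ [ A' ]) (Δ ++ []) n
  invert = Run.transform handle

-- The mix on P traverses the proof in which P is to be deleted on the left
-- (for P = ◇A: on the right), adding the sides of the other proof Π as extra
-- formulas.  An axiom P ⊢ P becomes Π itself.  At an introduction of P the
-- transformed premises are cut, on the immediate subformulas of P, against
-- the inversion of Π; these cuts have degree deg P = n.

snoc₋⊆ : ∀ {P} Γ₀ Z (A : PFormula) E → Γ₀ ⊆ Z → ((Γ₀ ++ [ A ]) ₋ P) ++ E ⊆ A ∷ ((Z ₋ P) ++ E)
snoc₋⊆ {P} Γ₀ Z A E s = ++⊆ (₋⊆ (Γ₀ ++ [ A ]) kept) (λ q → there (∈-++⁺ʳ _ q))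
  where
  kept : ∀ {Q} → Q ∈ Γ₀ ++ [ A ] → Q ≢ P → Q ∈ A ∷ ((Z ₋ P) ++ E)
  kept q Q≢P with ∈-snoc⁻ Γ₀ q
  ... | inj₁ q' = there (∈-++⁺ˡ (∈-₋⁺ Z (s q') Q≢P))
  ... | inj₂ refl = here refl

deg-subˡ : ∀ {A B n} → suc (deg A ⊔ deg B) ≡ n → suc (deg A) ≤ n
deg-subˡ {A} {B} e = ≤-trans (s≤s (m≤m⊔n (deg A) (deg B))) (≤-reflexive e)

deg-subʳ : ∀ {A B n} → suc (deg A ⊔ deg B) ≡ n → suc (deg B) ≤ n
deg-subʳ {A} {B} e = ≤-trans (s≤s (m≤n⊔m (deg A) (deg B))) (≤-reflexive e)

mix-axiom : ∀ {S n P Γ Δ} → Prv S Γ Δ n → Prv S (([ P ] ₋ P) ++ Γ) (P ∷ (Δ ₋ P)) n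
mix-axiom {Δ = Δ} = struct (∈-++⁺ʳ _) (⊆∷₋ Δ)

MixResult : System → ℕ → PFormula → List PFormula → List PFormula → Set
MixResult S n P Γ Δ = ∀ {Γ' Δ'} (π : Proof S Γ' Δ') → g π ≤ n → Prv S ((Γ' ₋ P) ++ Γ) (Δ' ++ (Δ ₋ P)) n

-- A propositional symbol is introduced only by axioms.
mixVar : ∀ S n p α {Γ Δ} → Prv S Γ Δ n → MixResult S n (var p ^ α) Γ Δ
mixVar S n p α {Γ} {Δ} Π = Run.transform handle
  where
    open Traversal S n (onLeft (var p ^ α)) nothing Γ (Δ ₋ (var p ^ α))
    handle : Handler
    handle k π pp h gd rec with introL π pp
    ... | axL _ = mix-axiom Π

mix¬ : ∀ S n A α → suc (deg A) ≡ n → {Γ Δ : List PFormula} → Prv S Γ Δ n → MixResult S n ((¬ᶠ A) ^ α) Γ Δ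
mix¬ S n A α degP {Γ} {Δ} (Π , dΠ) = Run.transform handle
  where
    P : PFormula
    P = (¬ᶠ A) ^ α
    open Traversal S n (onLeft P) nothing Γ (Δ ₋ P)
    open Rules⊆ {S} {n}

    handle : Handler
    handle k π pp h gd rec with introL π pp
    ... | axL _ = mix-axiom (Π , dΠ)
    ... | ¬L-intro {Γ₀} {Δ₀} _ _ π₀ =
      cut⊆ (A ^ α) (≤-reflexive degP) (rec π₀ h gd) (Invert¬R.invert S n A α Π dΠ)
        (₋++⊆ Γ₀ (Γ₀ ++ [ P ]) Γ (λ q → inj₂ (∈-++⁺ˡ q)))
        (++⊆ (λ q → there (∈-++⁺ʳ _ q)) (∈-∷⁺ʳ (here refl) []⊆))
        ⊆-refl
        (++⊆ (∈-++⁺ʳ Δ₀) []⊆)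

mix∧ : ∀ S n A B α → suc (deg A ⊔ deg B) ≡ n → {Γ Δ : List PFormula} → Prv S Γ Δ n →
       MixResult S n ((A ∧ᶠ B) ^ α) Γ Δ
mix∧ S n A B α degP {Γ} {Δ} (Π , dΠ) = Run.transform handle
  where
    P : PFormula
    P = (A ∧ᶠ B) ^ α
    open Traversal S n (onLeft P) nothing Γ (Δ ₋ P)
    open Rules⊆ {S} {n}

    handle : Handler
    handle k π pp h gd rec with introL π pp
    ... | axL _ = mix-axiom (Π , dΠ)
    ... | ∧L₁-intro {Γ₀} {Δ₀} _ _ _ π₀ =
      cut⊆ (A ^ α) (deg-subˡ degP) (Invert∧R₁.invert S n A B α Π dΠ) (rec π₀ h gd)
        (λ q → ∈-++⁺ʳ _ (++[]⊆ q))
        (snoc₋⊆ Γ₀ (Γ₀ ++ [ P ]) (A ^ α) Γ ∈-++⁺ˡ)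
        (++⊆ (λ q → there (∈-++⁺ʳ Δ₀ q)) (∈-∷⁺ʳ (here refl) []⊆))
        ⊆-refl
    ... | ∧L₂-intro {Γ₀} {Δ₀} _ _ _ π₀ =
      cut⊆ (B ^ α) (deg-subʳ degP) (Invert∧R₂.invert S n A B α Π dΠ) (rec π₀ h gd)
        (λ q → ∈-++⁺ʳ _ (++[]⊆ q))
        (snoc₋⊆ Γ₀ (Γ₀ ++ [ P ]) (B ^ α) Γ ∈-++⁺ˡ)
        (++⊆ (λ q → there (∈-++⁺ʳ Δ₀ q)) (∈-∷⁺ʳ (here refl) []⊆))
        ⊆-refl

mix∨ : ∀ S n A B α → suc (deg A ⊔ deg B) ≡ n → {Γ Δ : List PFormula} → Prv S Γ Δ n →
       MixResult S n ((A ∨ᶠ B) ^ α) Γ Δ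
mix∨ S n A B α degP {Γ} {Δ} (Π , dΠ) = Run.transform handle
  where
    P : PFormula
    P = (A ∨ᶠ B) ^ α
    open Traversal S n (onLeft P) nothing Γ (Δ ₋ P)
    open Rules⊆ {S} {n}

    handle : Handler
    handle k π pp h gd rec with introL π pp
    ... | axL _ = mix-axiom (Π , dΠ)
    ... | ∨L-intro {Γ₁} {Δ₁} {Γ₂} {Δ₂} _ _ _ π₁ π₂ =
      cut⊆ (B ^ α) (deg-subʳ degP) cutA (rec π₂ (<-premise₂ h) (⊔-boundʳ gd))
        ⊆-refl
        (snoc₋⊆ Γ₂ (Γ₁ ++ Γ₂ ++ [ P ]) (B ^ α) Γ (λ q → ∈-++⁺ʳ Γ₁ (∈-++⁺ˡ q)))
        ⊆-refl
        (++⊆ (λ q → ∈-++⁺ˡ (∈-++⁺ʳ Δ₁ q)) (∈-++⁺ʳ (Δ₁ ++ Δ₂)))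
      where
      -- Π inverted gives A^α, B^α on the right; cutting A^α against the
      -- A-premise leaves B^α, to be cut against the B-premise.
      cutA : Prv S (outL (Γ₁ ++ Γ₂ ++ [ P ])) ((B ^ α) ∷ outR (Δ₁ ++ Δ₂)) n
      cutA = cut⊆ (A ^ α) (deg-subˡ degP) (Invert∨R.invert S n A B α Π dΠ) (rec π₁ (<-premise₁ h) (⊔-boundˡ gd))
        (λ q → ∈-++⁺ʳ _ (++[]⊆ q))
        (snoc₋⊆ Γ₁ (Γ₁ ++ Γ₂ ++ [ P ]) (A ^ α) Γ ∈-++⁺ˡ)
        (++⊆ (λ q → there (there (∈-++⁺ʳ (Δ₁ ++ Δ₂) q))) (∈-∷⁺ʳ (here refl) (∈-∷⁺ʳ (there (here refl)) []⊆)))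
        (++⊆ (λ q → there (∈-++⁺ˡ (∈-++⁺ˡ q))) (λ q → there (∈-++⁺ʳ (Δ₁ ++ Δ₂) q)))

mix⇒ : ∀ S n A B α → suc (deg A ⊔ deg B) ≡ n → {Γ Δ : List PFormula} → Prv S Γ Δ n →
       MixResult S n ((A ⇒ᶠ B) ^ α) Γ Δ
mix⇒ S n A B α degP {Γ} {Δ} (Π , dΠ) = Run.transform handle
  where
    P : PFormula
    P = (A ⇒ᶠ B) ^ α
    open Traversal S n (onLeft P) nothing Γ (Δ ₋ P)
    open Rules⊆ {S} {n}

    handle : Handler
    handle k π pp h gd rec with introL π pp
    ... | axL _ = mix-axiom (Π , dΠ)
    ... | ⇒L-intro {Γ₁} {Δ₁} {Γ₂} {Δ₂} _ _ _ π₁ π₂ =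
      cut⊆ (B ^ α) (deg-subʳ degP) cutA (rec π₂ (<-premise₂ h) (⊔-boundʳ gd))
        ⊆-refl
        (snoc₋⊆ Γ₂ (Γ₁ ++ Γ₂ ++ [ P ]) (B ^ α) Γ (λ q → ∈-++⁺ʳ Γ₁ (∈-++⁺ˡ q)))
        ⊆-refl
        (++⊆ (λ q → ∈-++⁺ˡ (∈-++⁺ʳ Δ₁ q)) (∈-++⁺ʳ (Δ₁ ++ Δ₂)))
      where
      -- Π inverted has A^α on the left and B^α on the right; cutting A^α
      -- against the A-premise leaves B^α, to be cut against the B-premise.
      cutA : Prv S (outL (Γ₁ ++ Γ₂ ++ [ P ])) ((B ^ α) ∷ outR (Δ₁ ++ Δ₂)) n
      cutA = cut⊆ (A ^ α) (deg-subˡ degP) (rec π₁ (<-premise₁ h) (⊔-boundˡ gd)) (Invert⇒R.invert S n A B α Π dΠ)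
        (₋++⊆ Γ₁ (Γ₁ ++ Γ₂ ++ [ P ]) Γ (λ q → inj₂ (∈-++⁺ˡ q)))
        (++⊆ (λ q → there (∈-++⁺ʳ _ q)) (∈-∷⁺ʳ (here refl) []⊆))
        (∈-∷⁺ʳ (here refl) (++⊆ (λ q → there (there (∈-++⁺ˡ (∈-++⁺ˡ q)))) (λ q → there (there (∈-++⁺ʳ (Δ₁ ++ Δ₂) q)))))
        (++⊆ (λ q → there (∈-++⁺ʳ (Δ₁ ++ Δ₂) q)) (∈-∷⁺ʳ (here refl) []⊆))

-- For □A the cut is on A^(α++β), with β the extension chosen by □L.
mix□ : ∀ S n A α → suc (deg A) ≡ n → {Γ Δ : List PFormula} → Prv S Γ Δ n → MixResult S n ((□ A) ^ α) Γ Δ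
mix□ S n A α degP {Γ} {Δ} (Π , dΠ) = Run.transform handle
  where
    P : PFormula
    P = (□ A) ^ α
    open Traversal S n (onLeft P) nothing Γ (Δ ₋ P)
    open Rules⊆ {S} {n}

    handle : Handler
    handle k π pp h gd rec with introL π pp
    ... | axL _ = mix-axiom (Π , dΠ)
    ... | □L-intro {Γ₀} {Δ₀} _ _ β al π₀ =
      cut⊆ (A ^ (α ++ β)) (≤-reflexive degP) (Invert□R.invert S n A α β al Π dΠ) (rec π₀ h gd)
        (λ q → ∈-++⁺ʳ _ (++[]⊆ q))
        (snoc₋⊆ Γ₀ (Γ₀ ++ [ P ]) (A ^ (α ++ β)) Γ ∈-++⁺ˡ)
        (++⊆ (λ q → there (∈-++⁺ʳ Δ₀ q)) (∈-∷⁺ʳ (here refl) []⊆))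
        ⊆-refl

-- For ◇A the roles are exchanged: the proof with ◇A on the right is
-- traversed, and at a ◇R step at α++β the premise is cut against the
-- ◇L-inversion of the other proof on A^(α++β).
mix◇ : ∀ S n A α → suc (deg A) ≡ n → {Γ' Δ' : List PFormula} → Prv S Γ' Δ' n →
       ∀ {Γ Δ} (π : Proof S Γ Δ) → g π ≤ n → Prv S (Γ ++ (Γ' ₋ ((◇ A) ^ α))) ((Δ ₋ ((◇ A) ^ α)) ++ Δ') n
mix◇ S n A α degP {Γ'} {Δ'} (Π' , dΠ') = Run.transform handle
  where
    P : PFormula
    P = (◇ A) ^ α
    open Traversal S n (onRight P) nothing (Γ' ₋ P) Δ'
    open Rules⊆ {S} {n}

    handle : Handler
    handle k π pp h gd rec with introR π pp
    ... | axR _ = struct (⊆∷₋ Γ') (∈-++⁺ʳ _) (Π' , dΠ')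
    ... | ◇R-intro {Γ₀} {Δ₀} _ _ β al π₀ =
      cut⊆ (A ^ (α ++ β)) (≤-reflexive degP) (rec π₀ h gd) (Invert◇L.invert S n A α β al Π' dΠ')
        ⊆-refl
        (++⊆ (λ q → there (∈-++⁺ʳ Γ₀ q)) (∈-∷⁺ʳ (here refl) []⊆))
        (++⊆ (₋⊆ ((A ^ (α ++ β)) ∷ Δ₀) kept) (λ q → there (∈-++⁺ʳ _ q)))
        (++⊆ (∈-++⁺ʳ _) []⊆)
      where
      kept : ∀ {Q} → Q ∈ (A ^ (α ++ β)) ∷ Δ₀ → Q ≢ P → Q ∈ (A ^ (α ++ β)) ∷ (((P ∷ Δ₀) ₋ P) ++ Δ')
      kept (here refl) Q≢P = here refl
      kept (there q) Q≢P = there (∈-++⁺ˡ (∈-₋⁺ (P ∷ Δ₀) (there q) Q≢P))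

swapSides : ∀ {S n} Γ Γ' Δ Δ' → Prv S (Γ' ++ Γ) (Δ' ++ Δ) n → Prv S (Γ ++ Γ') (Δ ++ Δ') n
swapSides Γ Γ' Δ Δ' = struct (++⊆ (∈-++⁺ʳ Γ) ∈-++⁺ˡ) (++⊆ (∈-++⁺ʳ Δ) ∈-++⁺ˡ)

mainTheorem11 : (S : System) (n : ℕ) (P : PFormula) → pdeg P ≡ n →
    {Γ Δ Γ′ Δ′ : List PFormula} →
    (Π : Proof S Γ Δ) (Π′ : Proof S Γ′ Δ′) → g Π ≤ n → g Π′ ≤ n →
    Σ (Proof S (Γ ++ (Γ′ ₋ P)) ((Δ ₋ P) ++ Δ′)) (λ Σ′ → g Σ′ ≤ n)
mainTheorem11 S n (var p ^ α) dP {Γ} {Δ′ = Δ′} Π Π′ dΠ dΠ′ =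
  swapSides Γ _ _ Δ′ (mixVar S n p α (Π , dΠ) Π′ dΠ′)
mainTheorem11 S n ((¬ᶠ A) ^ α) dP {Γ} {Δ′ = Δ′} Π Π′ dΠ dΠ′ =
  swapSides Γ _ _ Δ′ (mix¬ S n A α dP (Π , dΠ) Π′ dΠ′)
mainTheorem11 S n ((A ∧ᶠ B) ^ α) dP {Γ} {Δ′ = Δ′} Π Π′ dΠ dΠ′ =
  swapSides Γ _ _ Δ′ (mix∧ S n A B α dP (Π , dΠ) Π′ dΠ′)
mainTheorem11 S n ((A ∨ᶠ B) ^ α) dP {Γ} {Δ′ = Δ′} Π Π′ dΠ dΠ′ =
  swapSides Γ _ _ Δ′ (mix∨ S n A B α dP (Π , dΠ) Π′ dΠ′)
mainTheorem11 S n ((A ⇒ᶠ B) ^ α) dP {Γ} {Δ′ = Δ′} Π Π′ dΠ dΠ′ =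
  swapSides Γ _ _ Δ′ (mix⇒ S n A B α dP (Π , dΠ) Π′ dΠ′)
mainTheorem11 S n ((□ A) ^ α) dP {Γ} {Δ′ = Δ′} Π Π′ dΠ dΠ′ =
  swapSides Γ _ _ Δ′ (mix□ S n A α dP (Π , dΠ) Π′ dΠ′)
mainTheorem11 S n ((◇ A) ^ α) dP Π Π′ dΠ dΠ′ = mix◇ S n A α dP (Π′ , dΠ′) Π dΠ
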